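{- Let $G$ be a connected graph on $n\geq 2$ vertices and let $v\in V(G)$. For integers $k\geq 0$, $l\geq 1$, let $G_{k,l}$ be the graph obtained from $G$ by attaching at $v$ two new paths $vv_1v_2\cdots v_k$ and $vu_1u_2\cdots u_l$ of lengths $k$ and $l$, where $v_1,\dots,v_k,u_1,\dots,u_l$ are distinct new vertices (for $k=0$ only the second path is attached). If $1\leq k\leq l$, then $F(G_{k-1,l+1})<F(G_{k,l})$.
   Context: All graphs are finite, simple and undirected. A connected subgraph of a graph $G=(V,E)$ is a graph $(V',E')$ with $\emptyset\neq V'\subseteq V$, $E'\subseteq E$, every edge of $E'$ having both endpoints in $V'$, and $(V',E')$ connected; distinct pairs $(V',E')$ are counted separately. The core index $F(G)$ is the number of connected subgraphs of $G$. -}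

module Defs where

open import Data.Bool using (Bool; true; false; _∧_; _∨_; not; T; if_then_else_)
open import Data.Bool.Properties using (∨-comm)
open import Data.Nat using (ℕ; zero; suc; _+_; _<ᵇ_; _≡ᵇ_)
open import Data.Fin using (Fin; toℕ; splitAt)
open import Data.List using (List; []; _∷_; length; concatMap; allFin; filterᵇ; map)
open import Data.Nat.ListAction using (sum)
open import Data.Vec using (Vec; []; _∷_; lookup)
open import Data.Product using (_×_; _,_)
open import Data.Sum using (_⊎_; inj₁; inj₂)
open import Relation.Binary.PropositionalEquality using (_≡_; refl)

record Graph : Set where
  field
    n      : ℕ
    adj    : Fin n → Fin n → Bool
    sym    : ∀ i j → adj i j ≡ adj j i
    irrefl : ∀ i → adj i i ≡ false

open Graph public

_==_ : ∀ {N} → Fin N → Fin N → Bool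
a == b = toℕ a ≡ᵇ toℕ b

anyF : ∀ {N} → (Fin N → Bool) → Bool
anyF {zero}  p = false
anyF {suc N} p = p Fin.zero ∨ anyF (λ x → p (Fin.suc x))

allF : ∀ {N} → (Fin N → Bool) → Bool
allF {zero}  p = true
allF {suc N} p = p Fin.zero ∧ allF (λ x → p (Fin.suc x))

walk : ∀ {N} → (Fin N → Fin N → Bool) → ℕ → Fin N → Fin N → Bool
walk R zero    u w = u == w
walk R (suc k) u w = walk R k u w ∨ anyF (λ x → R u x ∧ walk R k x w)

-- G is connected: any two vertices are joined by a walk
-- (length ≤ n suffices in an n-vertex graph).
Connected : Graph → Set
Connected G = ∀ u w → T (walk (adj G) (n G) u w)

edges : (G : Graph) → List (Fin (n G) × Fin (n G))
edges G = concatMap (λ i → concatMap (λ j →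
            if (toℕ i <ᵇ toℕ j) ∧ adj G i j then (i , j) ∷ [] else [])
            (allFin (n G))) (allFin (n G))

-- A subset E' of a list of edges, given as a Bool vector; the induced
-- adjacency relation of the chosen edges.
chosenAdj : ∀ {N} (es : List (Fin N × Fin N)) → Vec Bool (length es) → Fin N → Fin N → Bool
chosenAdj []             []       u x = false
chosenAdj ((a , b) ∷ es) (c ∷ cs) u x =
  (c ∧ ((a == u ∧ b == x) ∨ (a == x ∧ b == u))) ∨ chosenAdj es cs u x

endpointsIn : ∀ {N} (es : List (Fin N × Fin N)) → Vec Bool (length es) → Vec Bool N → Bool
endpointsIn []             []       S = true
endpointsIn ((a , b) ∷ es) (c ∷ cs) S =
  (not c ∨ (lookup S a ∧ lookup S b)) ∧ endpointsIn es cs S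

isConnSub : (G : Graph) → Vec Bool (n G) → Vec Bool (length (edges G)) → Bool
isConnSub G S E =
  anyF (lookup S) ∧ endpointsIn (edges G) E S ∧
  allF (λ u → allF (λ w →
    not (lookup S u ∧ lookup S w) ∨ walk (chosenAdj (edges G) E) (n G) u w))

allVecs : (m : ℕ) → List (Vec Bool m)
allVecs zero    = [] ∷ []
allVecs (suc m) = concatMap (λ v → (true ∷ v) ∷ (false ∷ v) ∷ []) (allVecs m)

F : Graph → ℕ
F G = sum (map (λ S → length (filterᵇ (isConnSub G S) (allVecs (length (edges G)))))
               (allVecs (n G)))

-- G_{k,l}: attach at v the paths v v₁ … v_k and v u₁ … u_l.
-- Vertex set Fin (n + (k + l)): first the n old vertices, then
-- v₁ … v_k (path index 0 … k-1), then u₁ … u_l (path index 0 … l-1).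

data Kind (n k l : ℕ) : Set where
  old : Fin n → Kind n k l
  pv  : Fin k → Kind n k l
  pu  : Fin l → Kind n k l

classify : ∀ {n k l} → Fin (n + (k + l)) → Kind n k l
classify {n} {k} {l} x with splitAt n x
... | inj₁ a = old a
... | inj₂ y with splitAt k y
...   | inj₁ i = pv i
...   | inj₂ j = pu j

next : ∀ {m} → Fin m → Fin m → Bool
next i j = (suc (toℕ i) ≡ᵇ toℕ j) ∨ (suc (toℕ j) ≡ᵇ toℕ i)

kadj : ∀ {k l} (G : Graph) → Fin (n G) → Kind (n G) k l → Kind (n G) k l → Bool
kadj G v (old a) (old b) = adj G a b
kadj G v (old a) (pv i)  = (a == v) ∧ (toℕ i ≡ᵇ 0)
kadj G v (pv i)  (old a) = (a == v) ∧ (toℕ i ≡ᵇ 0)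
kadj G v (old a) (pu j)  = (a == v) ∧ (toℕ j ≡ᵇ 0)
kadj G v (pu j)  (old a) = (a == v) ∧ (toℕ j ≡ᵇ 0)
kadj G v (pv i)  (pv j)  = next i j
kadj G v (pu i)  (pu j)  = next i j
kadj G v (pv i)  (pu j)  = false
kadj G v (pu j)  (pv i)  = false

private
  kadj-sym : ∀ {k l} G v (x y : Kind (n G) k l) → kadj G v x y ≡ kadj G v y x
  kadj-sym G v (old a) (old b) = sym G a b
  kadj-sym G v (old a) (pv i)  = refl
  kadj-sym G v (pv i)  (old a) = refl
  kadj-sym G v (old a) (pu j)  = refl
  kadj-sym G v (pu j)  (old a) = refl
  kadj-sym G v (pv i)  (pv j)  = ∨-comm (suc (toℕ i) ≡ᵇ toℕ j) _
  kadj-sym G v (pu i)  (pu j)  = ∨-comm (suc (toℕ i) ≡ᵇ toℕ j) _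
  kadj-sym G v (pv i)  (pu j)  = refl
  kadj-sym G v (pu j)  (pv i)  = refl

  suc≢ᵇ : ∀ m → (suc m ≡ᵇ m) ≡ false
  suc≢ᵇ zero    = refl
  suc≢ᵇ (suc m) = suc≢ᵇ m

  next-irr : ∀ {m} (i : Fin m) → next i i ≡ false
  next-irr i rewrite suc≢ᵇ (toℕ i) = refl

  kadj-irr : ∀ {k l} G v (x : Kind (n G) k l) → kadj G v x x ≡ false
  kadj-irr G v (old a) = irrefl G a
  kadj-irr G v (pv i)  = next-irr i
  kadj-irr G v (pu i)  = next-irr i

attach : (G : Graph) → Fin (n G) → (k l : ℕ) → Graph
attach G v k l = record
  { n      = n G + (k + l)
  ; adj    = λ x y → kadj G v (classify {n G} {k} {l} x) (classify {n G} {k} {l} y)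
  ; sym    = λ x y → kadj-sym G v (classify {n G} {k} {l} x) (classify {n G} {k} {l} y)
  ; irrefl = λ x → kadj-irr G v (classify {n G} {k} {l} x)
  }

module Submission where

-- Lemma 3.4 is proved by computing the core index of G_{p,q} exactly.  Let
-- Y (resp. X) be the number of connected subgraphs of G containing (resp.
-- avoiding) v, and T m = m(m+1)/2.  A connected subgraph of G_{p,q} either
-- meets G, and is a connected subgraph of G plus an initial segment of each
-- path (nonempty only if it contains v), or lies inside one path.  Hence
--     F(G_{p,q}) = (p+1)(q+1) Y + X + T p + T q,
-- and as Y ≥ 2 (take {v} and {v, w} for a neighbour w of v) we get
-- F(G_{k,l}) - F(G_{k-1,l+1}) = (l-k+1)(Y-1) > 0.

module Basics where

  open import Defs using (_==_; anyF; allF)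
  open import Data.Bool using (Bool; true; false; _∧_; _∨_; not; T; if_then_else_)
  open import Data.Bool.Properties using (∨-zeroʳ; T-≡)
  open import Data.Nat using (ℕ; zero; suc)
  open import Data.Nat.Properties using (≡ᵇ⇒≡; ≡⇒≡ᵇ)
  open import Data.Fin using (Fin; toℕ)
  import Data.Fin as F
  open import Data.Fin.Properties using (toℕ-injective)
  open import Data.Product using (Σ; _×_; _,_; proj₁; proj₂)
  open import Data.Sum using (_⊎_; inj₁; inj₂)
  open import Data.Empty using (⊥)
  open import Function.Bundles using (Equivalence)
  open import Relation.Binary.PropositionalEquality

  T→≡ : ∀ {b} → T b → b ≡ true
  T→≡ = Equivalence.to T-≡

  ≡→T : ∀ {b} → b ≡ true → T b
  ≡→T = Equivalence.from T-≡

  ∨-T : ∀ {a b} → a ∨ b ≡ true → a ≡ true ⊎ b ≡ true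
  ∨-T {true}  _ = inj₁ refl
  ∨-T {false} e = inj₂ e

  ∧-T : ∀ {a b} → a ∧ b ≡ true → a ≡ true × b ≡ true
  ∧-T {true} e = refl , e

  ∨-l : ∀ {a} b → a ≡ true → a ∨ b ≡ true
  ∨-l b refl = refl

  ∨-r : ∀ a {b} → b ≡ true → a ∨ b ≡ true
  ∨-r a refl = ∨-zeroʳ a

  ∧-i : ∀ {a b} → a ≡ true → b ≡ true → a ∧ b ≡ true
  ∧-i refl refl = refl

  ⇒ᵇ-intro : ∀ s {r} → (s ≡ true → r ≡ true) → (not s ∨ r) ≡ true
  ⇒ᵇ-intro true  h = h refl
  ⇒ᵇ-intro false h = refl

  ⇒ᵇ-elim : ∀ s {r} → (not s ∨ r) ≡ true → s ≡ true → r ≡ true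
  ⇒ᵇ-elim true h refl = h

  t≢f : true ≡ false → ⊥
  t≢f ()

  true∧false : ∀ {b} → b ≡ true → b ≡ false → ⊥
  true∧false p q = t≢f (trans (sym p) q)

  if-true : ∀ {A : Set} {c} {a b : A} → c ≡ true → (if c then a else b) ≡ a
  if-true refl = refl

  if-false : ∀ {A : Set} {c} {a b : A} → c ≡ false → (if c then a else b) ≡ b
  if-false refl = refl

  bool-ext : ∀ {a b} → (a ≡ true → b ≡ true) → (b ≡ true → a ≡ true) → a ≡ b
  bool-ext {true}  h k = sym (h refl)
  bool-ext {false} {true} h k = k refl
  bool-ext {false} {false} h k = refl

  𝟙 : Bool → ℕ
  𝟙 true  = 1
  𝟙 false = 0

  ==-true : ∀ {N} {a b : Fin N} → a == b ≡ true → a ≡ b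
  ==-true {a = a} {b} e = toℕ-injective (≡ᵇ⇒≡ (toℕ a) (toℕ b) (≡→T e))

  ==-refl : ∀ {N} (a : Fin N) → a == a ≡ true
  ==-refl a = T→≡ (≡⇒≡ᵇ (toℕ a) (toℕ a) refl)

  anyF-∃ : ∀ {N} (p : Fin N → Bool) → anyF p ≡ true → Σ (Fin N) λ x → p x ≡ true
  anyF-∃ {suc N} p e with ∨-T {p F.zero} e
  ... | inj₁ h = F.zero , h
  ... | inj₂ h with anyF-∃ (λ x → p (F.suc x)) h
  ...   | x , hx = F.suc x , hx

  anyF-intro : ∀ {N} (p : Fin N → Bool) x → p x ≡ true → anyF p ≡ true
  anyF-intro p F.zero    h rewrite h = refl
  anyF-intro p (F.suc x) h rewrite anyF-intro (λ y → p (F.suc y)) x h = ∨-zeroʳ (p F.zero)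

  anyF-false : ∀ {N} (p : Fin N → Bool) → anyF p ≡ false → ∀ x → p x ≡ false
  anyF-false p e x with p x in eq
  ... | false = refl
  ... | true with trans (sym (anyF-intro p x eq)) e
  ...   | ()

  allF-∀ : ∀ {N} (p : Fin N → Bool) → allF p ≡ true → ∀ x → p x ≡ true
  allF-∀ {suc N} p e F.zero    = proj₁ (∧-T e)
  allF-∀ {suc N} p e (F.suc x) = allF-∀ (λ y → p (F.suc y)) (proj₂ (∧-T {p F.zero} e)) x

  allF-intro : ∀ {N} (p : Fin N → Bool) → (∀ x → p x ≡ true) → allF p ≡ true
  allF-intro {zero}  p h = refl
  allF-intro {suc N} p h = ∧-i (h F.zero) (allF-intro (λ y → p (F.suc y)) (λ y → h (F.suc y)))

  allF-false : ∀ {N} (p : Fin N → Bool) → allF p ≡ false → Σ (Fin N) λ x → p x ≡ false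
  allF-false {suc N} p e with p F.zero in eq
  ... | false = F.zero , eq
  ... | true with allF-false (λ y → p (F.suc y)) e
  ...   | x , hx = F.suc x , hx

  anyF-ext : ∀ {N} (p q : Fin N → Bool) → (∀ x → p x ≡ q x) → anyF p ≡ anyF q
  anyF-ext {zero}  p q h = refl
  anyF-ext {suc N} p q h = cong₂ _∨_ (h F.zero) (anyF-ext _ _ (λ x → h (F.suc x)))

  allF-ext : ∀ {N} (p q : Fin N → Bool) → (∀ x → p x ≡ q x) → allF p ≡ allF q
  allF-ext {zero}  p q h = refl
  allF-ext {suc N} p q h = cong₂ _∧_ (h F.zero) (allF-ext _ _ (λ x → h (F.suc x)))

module Walks where

  open import Defs using (walk; anyF; allF; _==_)
  open Basics
  open import Data.Bool using (Bool; true; false; _∧_; _∨_; not)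
  open import Data.Nat using (ℕ; zero; suc; _+_; _∸_; _≤_; _<_; z≤n; s≤s)
  open import Data.Nat.Properties
  open import Data.Fin using (Fin)
  import Data.Fin as F
  open import Data.Product using (Σ; _×_; _,_; proj₁; proj₂)
  open import Data.Sum using (_⊎_; inj₁; inj₂)
  open import Data.Empty using (⊥-elim)
  open import Relation.Binary.PropositionalEquality

  -- We work instead with the inductive reachability relation
  -- 'Reach R', and show the two agree: any walk can be shortened to length
  -- at most N, the number of vertices.

  data Reach {N} (R : Fin N → Fin N → Bool) : Fin N → Fin N → Set where
    stay : ∀ {u} → Reach R u u
    step : ∀ {u x w} → R u x ≡ true → Reach R x w → Reach R u w

  walk-ext : ∀ {N} (R R' : Fin N → Fin N → Bool) → (∀ a b → R a b ≡ R' a b) →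
             ∀ k u w → walk R k u w ≡ walk R' k u w
  walk-ext R R' h zero    u w = refl
  walk-ext R R' h (suc k) u w =
    cong₂ _∨_ (walk-ext R R' h k u w)
      (anyF-ext _ _ (λ x → cong₂ _∧_ (h u x) (walk-ext R R' h k x w)))

  walk→Reach : ∀ {N} (R : Fin N → Fin N → Bool) k u w → walk R k u w ≡ true → Reach R u w
  walk→Reach R zero u w e with ==-true {a = u} {w} e
  ... | refl = stay
  walk→Reach R (suc k) u w e with ∨-T {walk R k u w} e
  ... | inj₁ h = walk→Reach R k u w h
  ... | inj₂ h with anyF-∃ _ h
  ...   | x , hx = step (proj₁ (∧-T hx)) (walk→Reach R k x w (proj₂ (∧-T {R u x} hx)))

  Reach→walk : ∀ {N} {R : Fin N → Fin N → Bool} {u w} → Reach R u w → Σ ℕ λ k → walk R k u w ≡ true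
  Reach→walk {u = u} stay = 0 , ==-refl u
  Reach→walk {R = R} {u = u} {w} (step {x = x} r rest) with Reach→walk rest
  ... | k , h = suc k , ∨-r (walk R k u w) (anyF-intro _ x (∧-i r h))

  walk-suc : ∀ {N} (R : Fin N → Fin N → Bool) k u w → walk R k u w ≡ true → walk R (suc k) u w ≡ true
  walk-suc R k u w h rewrite h = refl

  walk-≤ : ∀ {N} (R : Fin N → Fin N → Bool) {k k'} u w → k ≤ k' → walk R k u w ≡ true → walk R k' u w ≡ true
  walk-≤ R {k} {k'} u w le h = subst (λ j → walk R j u w ≡ true) (m∸n+n≡m le) (longer (k' ∸ k) h)
    where
    longer : ∀ d → walk R k u w ≡ true → walk R (d + k) u w ≡ true
    longer zero    h = h
    longer (suc d) h = walk-suc R (d + k) u w (longer d h)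

  countTrue : ∀ {N} → (Fin N → Bool) → ℕ
  countTrue {zero}  p = 0
  countTrue {suc N} p = 𝟙 (p F.zero) + countTrue (λ x → p (F.suc x))

  countTrue-≤N : ∀ {N} (p : Fin N → Bool) → countTrue p ≤ N
  countTrue-≤N {zero}  p = z≤n
  countTrue-≤N {suc N} p with p F.zero
  ... | true  = s≤s (countTrue-≤N _)
  ... | false = m≤n⇒m≤1+n (countTrue-≤N _)

  𝟙-mono : ∀ {a b} → (a ≡ true → b ≡ true) → 𝟙 a ≤ 𝟙 b
  𝟙-mono {false} h = z≤n
  𝟙-mono {true}  h rewrite h refl = s≤s z≤n

  countTrue-mono : ∀ {N} (p q : Fin N → Bool) → (∀ x → p x ≡ true → q x ≡ true) → countTrue p ≤ countTrue q
  countTrue-mono {zero}  p q h = z≤n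
  countTrue-mono {suc N} p q h = +-mono-≤ (𝟙-mono (h F.zero)) (countTrue-mono _ _ (λ x → h (F.suc x)))

  countTrue-strict : ∀ {N} (p q : Fin N → Bool) → (∀ x → p x ≡ true → q x ≡ true) →
                     ∀ y → q y ≡ true → p y ≡ false → countTrue p < countTrue q
  countTrue-strict {suc N} p q h F.zero qy py rewrite qy | py =
    s≤s (countTrue-mono _ _ (λ x → h (F.suc x)))
  countTrue-strict {suc N} p q h (F.suc y) qy py =
    +-mono-≤-< (𝟙-mono (h F.zero)) (countTrue-strict _ _ (λ x → h (F.suc x)) y qy py)

  countTrue-pos : ∀ {N} (p : Fin N → Bool) y → p y ≡ true → 1 ≤ countTrue p
  countTrue-pos {suc N} p F.zero    h rewrite h = s≤s z≤n
  countTrue-pos {suc N} p (F.suc y) h = ≤-trans (countTrue-pos _ y h) (m≤n+m _ (𝟙 (p F.zero)))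

  -- The sets
  -- W k = {u | u reaches w in ≤ k steps} increase with k; once W i = W (i+1)
  -- they are constant from i on, and they cannot grow strictly N times.
  -- Hence W k ⊆ W N for every k.
  module ShortWalks {N} (R : Fin N → Fin N → Bool) (w : Fin N) where

    W : ℕ → Fin N → Bool
    W k u = walk R k u w

    Stable : ℕ → Set
    Stable i = ∀ u → W (suc i) u ≡ true → W i u ≡ true

    step-mono : ∀ (A B : Fin N → Bool) → (∀ u → A u ≡ true → B u ≡ true) → ∀ u →
       (A u ∨ anyF (λ x → R u x ∧ A x)) ≡ true → (B u ∨ anyF (λ x → R u x ∧ B x)) ≡ true
    step-mono A B h u e with ∨-T {A u} e
    ... | inj₁ a = ∨-l _ (h u a)
    ... | inj₂ b with anyF-∃ _ b
    ...   | x , hx = ∨-r (B u) (anyF-intro _ x (∧-i (proj₁ (∧-T hx)) (h x (proj₂ (∧-T {R u x} hx)))))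

    stable-forever : ∀ i → Stable i → ∀ j u → W (j + i) u ≡ true → W i u ≡ true
    stable-forever i s zero    u h = h
    stable-forever i s (suc j) u h = s u (step-mono (W (j + i)) (W i) (stable-forever i s j) u h)

    -- a point where the inclusion W k ⊆ W (suc k) is strict
    new-point : ∀ a {b} → (not a ∨ b) ≡ false → a ≡ true × b ≡ false
    new-point true {false} _ = refl , refl

    stable-or-large : ∀ k → (Σ ℕ λ i → i < k × Stable i) ⊎ (suc k ≤ countTrue (W k))
    stable-or-large zero = inj₂ (countTrue-pos (W 0) w (==-refl w))
    stable-or-large (suc k) with stable-or-large k
    ... | inj₁ (i , i<k , s) = inj₁ (i , m<n⇒m<1+n i<k , s)
    ... | inj₂ large with allF (λ u → not (W (suc k) u) ∨ W k u) in eq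
    ...   | true = inj₁ (k , n<1+n k , stable)
      where
      stable : Stable k
      stable u h with allF-∀ _ eq u
      ... | e rewrite h = e
    ...   | false with allF-false _ eq
    ...     | u , hu with new-point (W (suc k) u) hu
    ...       | a , b = inj₂ (≤-<-trans large (countTrue-strict (W k) (W (suc k)) (λ x → walk-suc R k x w) u a b))

    shorten : ∀ k u → W k u ≡ true → W N u ≡ true
    shorten k u h with stable-or-large N
    ... | inj₂ large = ⊥-elim (<⇒≱ large (countTrue-≤N _))
    ... | inj₁ (i , i<N , s) =
      walk-≤ R u w (<⇒≤ i<N) (stable-forever i s k u (walk-≤ R u w (m≤m+n k i) h))

  Reach→walkN : ∀ {N} (R : Fin N → Fin N → Bool) {u w} → Reach R u w → walk R N u w ≡ true
  Reach→walkN R {u} {w} r with Reach→walk r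
  ... | k , h = ShortWalks.shorten R w k u h

  Reach-trans : ∀ {N} {R : Fin N → Fin N → Bool} {a b c} → Reach R a b → Reach R b c → Reach R a c
  Reach-trans stay       q = q
  Reach-trans (step r p) q = step r (Reach-trans p q)

  Reach-sym : ∀ {N} {R : Fin N → Fin N → Bool} → (∀ a b → R a b ≡ R b a) → ∀ {a b} → Reach R a b → Reach R b a
  Reach-sym s stay = stay
  Reach-sym s (step {u} {x} r p) = Reach-trans (Reach-sym s p) (step (trans (s x u) r) stay)

  Reach-map : ∀ {N M} {R : Fin N → Fin N → Bool} {R' : Fin M → Fin M → Bool} (f : Fin N → Fin M) →
              (∀ a b → R a b ≡ true → f a ≡ f b ⊎ R' (f a) (f b) ≡ true) →
              ∀ {x y} → Reach R x y → Reach R' (f x) (f y)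
  Reach-map f h stay = stay
  Reach-map f h (step {u} {x} r p) with h u x r
  ... | inj₁ e rewrite e = Reach-map f h p
  ... | inj₂ r' = step r' (Reach-map f h p)

  cut : ∀ {N} {R : Fin N → Fin N → Bool} (U : Fin N → Bool) {x y} → Reach R x y → U x ≡ true → U y ≡ false →
        Σ (Fin N) λ a → Σ (Fin N) λ b → U a ≡ true × U b ≡ false × R a b ≡ true
  cut U stay ux uy = ⊥-elim (t≢f (trans (sym ux) uy))
  cut U (step {u} {x} r p) ux uy with U x in eq
  ... | true  = cut U p eq uy
  ... | false = u , x , ux , eq , r

module VectorSums where

  open import Defs using (Graph; n; edges; isConnSub; allVecs; F)
  open Basics using (𝟙)
  open import Data.Bool using (Bool; true; false)
  open import Data.Bool.Properties renaming (_≟_ to _≟ᴮ_) using ()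
  open import Data.Nat using (ℕ; zero; suc; _+_; _*_; _≤_)
  open import Data.Nat.Properties
  open import Algebra.Properties.CommutativeSemigroup +-commutativeSemigroup using (interchange)
  open import Data.Vec using (Vec; []; _∷_; _++_)
  open import Data.Vec.Properties using (≡-dec)
  open import Data.List using (List; []; _∷_; length; concatMap; filterᵇ; map)
  open import Data.List.Properties using (map-cong)
  open import Data.Nat.ListAction using (sum)
  open import Data.Empty using (⊥-elim)
  open import Relation.Nullary using (¬_; yes; no)
  open import Relation.Binary.PropositionalEquality

  sumAll : (m : ℕ) → (Vec Bool m → ℕ) → ℕ
  sumAll zero    f = f []
  sumAll (suc m) f = sumAll m (λ v → f (true ∷ v) + f (false ∷ v))

  sumAll-ext : ∀ m (f g : Vec Bool m → ℕ) → (∀ v → f v ≡ g v) → sumAll m f ≡ sumAll m g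
  sumAll-ext zero    f g h = h []
  sumAll-ext (suc m) f g h = sumAll-ext m _ _ (λ v → cong₂ _+_ (h _) (h _))

  sumAll-+ : ∀ m (f g : Vec Bool m → ℕ) → sumAll m (λ v → f v + g v) ≡ sumAll m f + sumAll m g
  sumAll-+ zero    f g = refl
  sumAll-+ (suc m) f g =
    trans (sumAll-ext m _ _ (λ v → interchange (f (true ∷ v)) (g (true ∷ v)) (f (false ∷ v)) (g (false ∷ v))))
          (sumAll-+ m _ _)

  sumAll-* : ∀ m c (f : Vec Bool m → ℕ) → sumAll m (λ v → c * f v) ≡ c * sumAll m f
  sumAll-* zero    c f = refl
  sumAll-* (suc m) c f =
    trans (sumAll-ext m _ _ (λ v → sym (*-distribˡ-+ c (f (true ∷ v)) (f (false ∷ v)))))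
          (sumAll-* m c _)

  sumAll-0 : ∀ m → sumAll m (λ _ → 0) ≡ 0
  sumAll-0 zero    = refl
  sumAll-0 (suc m) = sumAll-0 m

  sumAll-*ʳ : ∀ m (f : Vec Bool m → ℕ) c → sumAll m (λ v → f v * c) ≡ sumAll m f * c
  sumAll-*ʳ m f c = trans (sumAll-ext m _ _ (λ v → *-comm (f v) c)) (trans (sumAll-* m c f) (*-comm c (sumAll m f)))

  sumAll-product : ∀ a b (f : Vec Bool a → ℕ) (g : Vec Bool b → ℕ) →
                   sumAll a (λ x → sumAll b (λ y → f x * g y)) ≡ sumAll a f * sumAll b g
  sumAll-product a b f g = trans (sumAll-ext a _ _ (λ x → sumAll-* b (f x) g)) (sumAll-*ʳ a f (sumAll b g))

  sumAll-split : ∀ a b (f : Vec Bool (a + b) → ℕ) → sumAll (a + b) f ≡ sumAll a (λ x → sumAll b (λ y → f (x ++ y)))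
  sumAll-split zero    b f = refl
  sumAll-split (suc a) b f = trans (sumAll-split a b _) (sumAll-ext a _ _ (λ x → sumAll-+ b _ _))

  sumAll-point : ∀ m (f : Vec Bool m → ℕ) v → f v ≤ sumAll m f
  sumAll-point zero    f []        = ≤-refl
  sumAll-point (suc m) f (true ∷ v)  = ≤-trans (m≤m+n (f (true ∷ v)) (f (false ∷ v))) (sumAll-point m _ v)
  sumAll-point (suc m) f (false ∷ v) = ≤-trans (m≤n+m (f (false ∷ v)) (f (true ∷ v))) (sumAll-point m _ v)

  sumAll-two : ∀ m (f : Vec Bool m → ℕ) v w → ¬ (v ≡ w) → f v + f w ≤ sumAll m f
  sumAll-two zero f [] [] v≢w = ⊥-elim (v≢w refl)
  sumAll-two (suc m) f (c ∷ v) (d ∷ w) cv≢dw with ≡-dec _≟ᴮ_ v w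
  ... | no v≢w  = ≤-trans (+-mono-≤ (pick c v) (pick d w)) (sumAll-two m _ v w v≢w)
    where
    pick : ∀ c v → f (c ∷ v) ≤ f (true ∷ v) + f (false ∷ v)
    pick true  v = m≤m+n _ _
    pick false v = m≤n+m _ _
  ... | yes refl = ≤-trans (both c d (λ c≡d → cv≢dw (cong (_∷ v) c≡d))) (sumAll-point m _ v)
    where
    both : ∀ c d → ¬ (c ≡ d) → f (c ∷ v) + f (d ∷ v) ≤ f (true ∷ v) + f (false ∷ v)
    both true  true  c≢d = ⊥-elim (c≢d refl)
    both false false c≢d = ⊥-elim (c≢d refl)
    both true  false _   = ≤-refl
    both false true  _   = ≤-reflexive (+-comm (f (false ∷ v)) (f (true ∷ v)))

  concatMap-pairs : ∀ {m} (f : Vec Bool (suc m) → ℕ) (xs : List (Vec Bool m)) →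
    sum (map f (concatMap (λ v → (true ∷ v) ∷ (false ∷ v) ∷ []) xs)) ≡
    sum (map (λ v → f (true ∷ v) + f (false ∷ v)) xs)
  concatMap-pairs f []       = refl
  concatMap-pairs f (x ∷ xs) = trans (sym (+-assoc (f (true ∷ x)) (f (false ∷ x)) _))
                                     (cong (f (true ∷ x) + f (false ∷ x) +_) (concatMap-pairs f xs))

  sum-allVecs : ∀ m (f : Vec Bool m → ℕ) → sum (map f (allVecs m)) ≡ sumAll m f
  sum-allVecs zero    f = +-identityʳ (f [])
  sum-allVecs (suc m) f = trans (concatMap-pairs f (allVecs m)) (sum-allVecs m _)

  length-filter : ∀ {A : Set} (P : A → Bool) (xs : List A) → length (filterᵇ P xs) ≡ sum (map (λ x → 𝟙 (P x)) xs)
  length-filter P [] = refl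
  length-filter P (x ∷ xs) with P x
  ... | true  = cong suc (length-filter P xs)
  ... | false = length-filter P xs

  F-as-sum : (H : Graph) → F H ≡ sumAll (n H) (λ S → sumAll (length (edges H)) (λ E → 𝟙 (isConnSub H S E)))
  F-as-sum H = begin
    sum (map (λ S → length (filterᵇ (isConnSub H S) (allVecs e))) (allVecs (n H)))
      ≡⟨ cong sum (map-cong (λ S → trans (length-filter (isConnSub H S) (allVecs e))
                                          (sum-allVecs e (λ E → 𝟙 (isConnSub H S E))))
                            (allVecs (n H))) ⟩
    sum (map (λ S → sumAll e (λ E → 𝟙 (isConnSub H S E))) (allVecs (n H)))
      ≡⟨ sum-allVecs (n H) _ ⟩
    sumAll (n H) (λ S → sumAll e (λ E → 𝟙 (isConnSub H S E))) ∎
    where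
    open ≡-Reasoning
    e : ℕ
    e = length (edges H)

module EdgeSelections where

  open import Defs using (n; edges; _==_; anyF; allF; walk; chosenAdj; endpointsIn; isConnSub)
  open Basics
  open Walks
  open VectorSums
  open import Data.Bool using (Bool; true; false; _∧_; _∨_; not; if_then_else_)
  open import Data.Bool.Properties using (∨-comm)
  open import Data.Nat using (ℕ; _+_)
  open import Data.Nat.Properties using (+-commutativeSemigroup)
  open import Algebra.Properties.CommutativeSemigroup +-commutativeSemigroup using (interchange)
  open import Data.Fin using (Fin)
  open import Data.Vec using (Vec; []; _∷_; lookup)
  open import Data.List using (List; []; _∷_; length; map; _++_)
  open import Data.List.Membership.Propositional using (_∈_)
  open import Data.List.Relation.Unary.Any using (here; there)
  open import Data.List.Relation.Binary.Permutation.Propositional using (_↭_; refl; prep; swap; trans; ↭-sym)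
  open import Data.List.Relation.Binary.Permutation.Propositional.Properties using (∈-resp-↭)
  open import Data.Product using (Σ; _×_; _,_; proj₁; proj₂)
  open import Data.Sum using (_⊎_; inj₁; inj₂)
  open import Relation.Binary.PropositionalEquality hiding (trans)
  import Relation.Binary.PropositionalEquality as Eq

  -- An edge subset of G is a boolean vector indexed by the list 'edges G'.
  -- We replace it by the list 'chosen es E' of selected edges, and restate
  -- the connectivity test of Defs as a predicate Φ on (vertex set, edge
  -- list).  Φ only depends on the edge list up to permutation, which lets
  -- us reorder the edges of G_{k,l} freely when counting.

  Pair : ℕ → Set
  Pair N = Fin N × Fin N

  chosen : ∀ {N} (es : List (Pair N)) → Vec Bool (length es) → List (Pair N)
  chosen []       []       = []
  chosen (x ∷ es) (c ∷ cs) = if c then x ∷ chosen es cs else chosen es cs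

  match : ∀ {N} → Pair N → Fin N → Fin N → Bool
  match (a , b) u x = (a == u ∧ b == x) ∨ (a == x ∧ b == u)

  adjL : ∀ {N} → List (Pair N) → Fin N → Fin N → Bool
  adjL []       u x = false
  adjL (z ∷ zs) u x = match z u x ∨ adjL zs u x

  allIn : ∀ {N} → List (Pair N) → Vec Bool N → Bool
  allIn []             S = true
  allIn ((a , b) ∷ zs) S = (lookup S a ∧ lookup S b) ∧ allIn zs S

  spans : ∀ N → Vec Bool N → List (Pair N) → Bool
  spans N S cl = allIn cl S ∧ allF (λ u → allF (λ w → not (lookup S u ∧ lookup S w) ∨ walk (adjL cl) N u w))

  Φ : ∀ N → Vec Bool N → List (Pair N) → Bool
  Φ N S cl = anyF (lookup S) ∧ spans N S cl

  chosenAdj-adjL : ∀ {N} (es : List (Pair N)) E u x → chosenAdj es E u x ≡ adjL (chosen es E) u x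
  chosenAdj-adjL []             []          u x = Eq.refl
  chosenAdj-adjL ((a , b) ∷ es) (true ∷ E)  u x = cong (_ ∨_) (chosenAdj-adjL es E u x)
  chosenAdj-adjL ((a , b) ∷ es) (false ∷ E) u x = chosenAdj-adjL es E u x

  endpointsIn-allIn : ∀ {N} (es : List (Pair N)) E S → endpointsIn es E S ≡ allIn (chosen es E) S
  endpointsIn-allIn []             []          S = Eq.refl
  endpointsIn-allIn ((a , b) ∷ es) (true ∷ E)  S = cong (_ ∧_) (endpointsIn-allIn es E S)
  endpointsIn-allIn ((a , b) ∷ es) (false ∷ E) S = endpointsIn-allIn es E S

  isConnSub-Φ : ∀ H S E → isConnSub H S E ≡ Φ (n H) S (chosen (edges H) E)
  isConnSub-Φ H S E = cong₂ (λ a b → anyF (lookup S) ∧ a ∧ b) (endpointsIn-allIn (edges H) E S)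
    (allF-ext _ _ (λ u → allF-ext _ _ (λ w → cong (_ ∨_)
      (walk-ext _ _ (chosenAdj-adjL (edges H) E) (n H) u w))))

  Joins : ∀ {N} → Pair N → Fin N → Fin N → Set
  Joins z a b = (proj₁ z ≡ a × proj₂ z ≡ b) ⊎ (proj₁ z ≡ b × proj₂ z ≡ a)

  adjL-∈ : ∀ {N} (cl : List (Pair N)) a b → adjL cl a b ≡ true → Σ (Pair N) λ z → z ∈ cl × Joins z a b
  adjL-∈ ((c , d) ∷ cl) a b e with ∨-T {match (c , d) a b} e
  ... | inj₂ r with adjL-∈ cl a b r
  ...   | z , m , o = z , there m , o
  adjL-∈ ((c , d) ∷ cl) a b e | inj₁ m with ∨-T {c == a ∧ d == b} m
  ... | inj₁ x = (c , d) , here Eq.refl , inj₁ (==-true (proj₁ (∧-T x)) , ==-true (proj₂ (∧-T {c == a} x)))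
  ... | inj₂ x = (c , d) , here Eq.refl , inj₂ (==-true (proj₁ (∧-T x)) , ==-true (proj₂ (∧-T {c == b} x)))

  ∈-adjL : ∀ {N} {cl : List (Pair N)} {z} → z ∈ cl → adjL cl (proj₁ z) (proj₂ z) ≡ true
  ∈-adjL {z = c , d} (here Eq.refl) rewrite ==-refl c | ==-refl d = Eq.refl
  ∈-adjL {cl = y ∷ cl} {z = c , d} (there p) = ∨-r (match y c d) (∈-adjL p)

  adjL-sym : ∀ {N} (cl : List (Pair N)) a b → adjL cl a b ≡ adjL cl b a
  adjL-sym []             a b = Eq.refl
  adjL-sym ((c , d) ∷ cl) a b = cong₂ _∨_ (∨-comm (c == a ∧ d == b) _) (adjL-sym cl a b)

  adjL-intro : ∀ {N} {cl : List (Pair N)} {z} a b → z ∈ cl → Joins z a b → adjL cl a b ≡ true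
  adjL-intro a b m (inj₁ (Eq.refl , Eq.refl)) = ∈-adjL m
  adjL-intro {cl = cl} a b m (inj₂ (Eq.refl , Eq.refl)) = Eq.trans (adjL-sym cl a b) (∈-adjL m)

  adjL-⊆ : ∀ {N} {xs ys : List (Pair N)} → (∀ {z} → z ∈ xs → z ∈ ys) → ∀ a b →
    adjL xs a b ≡ true → adjL ys a b ≡ true
  adjL-⊆ {xs = xs} h a b e with adjL-∈ xs a b e
  ... | z , m , o = adjL-intro a b (h m) o

  allIn-∈ : ∀ {N} {cl : List (Pair N)} {S z} → allIn cl S ≡ true → z ∈ cl →
    lookup S (proj₁ z) ≡ true × lookup S (proj₂ z) ≡ true
  allIn-∈ {cl = (a , b) ∷ cl} {S} e (here Eq.refl) = ∧-T (proj₁ (∧-T {lookup S a ∧ lookup S b} e))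
  allIn-∈ {cl = (a , b) ∷ cl} {S} e (there m)      = allIn-∈ (proj₂ (∧-T {lookup S a ∧ lookup S b} e)) m

  ∈-allIn : ∀ {N} (cl : List (Pair N)) S → (∀ {z} → z ∈ cl → lookup S (proj₁ z) ≡ true × lookup S (proj₂ z) ≡ true) →
    allIn cl S ≡ true
  ∈-allIn []             S h = Eq.refl
  ∈-allIn ((a , b) ∷ cl) S h with h (here Eq.refl)
  ... | e1 , e2 = ∧-i (∧-i e1 e2) (∈-allIn cl S (λ m → h (there m)))

  allIn-⊆ : ∀ {N} {xs ys : List (Pair N)} → (∀ {z} → z ∈ ys → z ∈ xs) → ∀ S →
    allIn xs S ≡ true → allIn ys S ≡ true
  allIn-⊆ {ys = ys} h S e = ∈-allIn ys S (λ m → allIn-∈ e (h m))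

  Φ-↭ : ∀ {N} S {xs ys : List (Pair N)} → xs ↭ ys → Φ N S xs ≡ Φ N S ys
  Φ-↭ {N} S {xs} {ys} p = cong₂ (λ a b → anyF (lookup S) ∧ a ∧ b)
    (bool-ext (allIn-⊆ (∈-resp-↭ (↭-sym p)) S) (allIn-⊆ (∈-resp-↭ p) S))
    (allF-ext _ _ (λ u → allF-ext _ _ (λ w → cong (_ ∨_) (walk-ext _ _ adj-↭ N u w))))
    where
    adj-↭ : ∀ a b → adjL xs a b ≡ adjL ys a b
    adj-↭ a b = bool-ext (adjL-⊆ (∈-resp-↭ p) a b) (adjL-⊆ (∈-resp-↭ (↭-sym p)) a b)

  sumChosen-↭ : ∀ {N} {es es' : List (Pair N)} → es ↭ es' → (Ψ : List (Pair N) → ℕ) →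
    (∀ {xs ys} → xs ↭ ys → Ψ xs ≡ Ψ ys) →
    sumAll (length es) (λ E → Ψ (chosen es E)) ≡ sumAll (length es') (λ E → Ψ (chosen es' E))
  sumChosen-↭ refl Ψ h = Eq.refl
  sumChosen-↭ {es = x ∷ es} {x ∷ es'} (prep x p) Ψ h =
    Eq.trans (sumAll-+ (length es) _ _)
     (Eq.trans (cong₂ _+_ (sumChosen-↭ p (λ c → Ψ (x ∷ c)) (λ q → h (prep x q))) (sumChosen-↭ p Ψ h))
       (sym (sumAll-+ (length es') _ _)))
  sumChosen-↭ {es = x ∷ y ∷ es} {y ∷ x ∷ es'} (swap x y p) Ψ h =
    Eq.trans (sumChosen-↭ p Ψ₂ h₂) (sumAll-ext (length es') _ _ (λ E → swapped (chosen es' E)))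
    where
    -- the four choices for the two swapped edges
    Ψ₂ : List (Pair _) → ℕ
    Ψ₂ c = (Ψ (x ∷ y ∷ c) + Ψ (y ∷ c)) + (Ψ (x ∷ c) + Ψ c)
    h₂ : ∀ {xs ys} → xs ↭ ys → Ψ₂ xs ≡ Ψ₂ ys
    h₂ q = cong₂ _+_ (cong₂ _+_ (h (prep x (prep y q))) (h (prep y q))) (cong₂ _+_ (h (prep x q)) (h q))
    swapped : ∀ c → Ψ₂ c ≡ (Ψ (y ∷ x ∷ c) + Ψ (x ∷ c)) + (Ψ (y ∷ c) + Ψ c)
    swapped c = Eq.trans (cong (λ t → (t + Ψ (y ∷ c)) + (Ψ (x ∷ c) + Ψ c)) (h (swap x y refl)))
                         (interchange (Ψ (y ∷ x ∷ c)) (Ψ (y ∷ c)) (Ψ (x ∷ c)) (Ψ c))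
  sumChosen-↭ (trans p q) Ψ h = Eq.trans (sumChosen-↭ p Ψ h) (sumChosen-↭ q Ψ h)

  sumChosen-++ : ∀ {N} (xs ys : List (Pair N)) (Ψ : List (Pair N) → ℕ) →
    sumAll (length (xs ++ ys)) (λ E → Ψ (chosen (xs ++ ys) E)) ≡
    sumAll (length xs) (λ E₁ → sumAll (length ys) (λ E₂ → Ψ (chosen xs E₁ ++ chosen ys E₂)))
  sumChosen-++ []       ys Ψ = Eq.refl
  sumChosen-++ (x ∷ xs) ys Ψ =
    Eq.trans (sumAll-+ (length (xs ++ ys)) _ _)
     (Eq.trans (cong₂ _+_ (sumChosen-++ xs ys (λ c → Ψ (x ∷ c))) (sumChosen-++ xs ys Ψ))
      (sym (sumAll-+ (length xs) _ _)))

  sumChosen-map : ∀ {N M} (f : Pair N → Pair M) (xs : List (Pair N)) (Ψ : List (Pair M) → ℕ) →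
    sumAll (length (map f xs)) (λ E → Ψ (chosen (map f xs) E)) ≡ sumAll (length xs) (λ E → Ψ (map f (chosen xs E)))
  sumChosen-map f []       Ψ = Eq.refl
  sumChosen-map f (x ∷ xs) Ψ = sumChosen-map f xs (λ c → Ψ (f x ∷ c) + Ψ c)

  ConnSub : ∀ N → Vec Bool N → List (Pair N) → Set
  ConnSub N S cl = (Σ (Fin N) λ u → lookup S u ≡ true) × (allIn cl S ≡ true) ×
                   (∀ u w → lookup S u ≡ true → lookup S w ≡ true → Reach (adjL cl) u w)

  Φ→ConnSub : ∀ N S cl → Φ N S cl ≡ true → ConnSub N S cl
  Φ→ConnSub N S cl e with ∧-T {anyF (lookup S)} e
  ... | e1 , e23 with ∧-T {allIn cl S} e23
  ... | e2 , e3 = anyF-∃ _ e1 , e2 , λ u w su sw → walk→Reach _ N u w (walkIn u w su sw)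
    where
    walkIn : ∀ u w → lookup S u ≡ true → lookup S w ≡ true → walk (adjL cl) N u w ≡ true
    walkIn u w su sw with allF-∀ _ (allF-∀ _ e3 u) w
    ... | h rewrite su | sw = h

  ConnSub→Φ : ∀ N S cl → ConnSub N S cl → Φ N S cl ≡ true
  ConnSub→Φ N S cl ((u , su) , ai , r) =
    ∧-i (anyF-intro _ u su) (∧-i ai (allF-intro _ (λ a → allF-intro _ (λ b → walkIn a b))))
    where
    walkIn : ∀ a b → (not (lookup S a ∧ lookup S b) ∨ walk (adjL cl) N a b) ≡ true
    walkIn a b with lookup S a in ea | lookup S b in eb
    ... | true  | true  = Reach→walkN _ (r a b ea eb)
    ... | true  | false = Eq.refl
    ... | false | _     = Eq.refl

  noneChosen : ∀ {m} → Vec Bool m → Bool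
  noneChosen []       = true
  noneChosen (c ∷ cs) = not c ∧ noneChosen cs

  chosen-noneChosen : ∀ {N} (es : List (Pair N)) E → noneChosen E ≡ true → chosen es E ≡ []
  chosen-noneChosen []       []          _ = Eq.refl
  chosen-noneChosen (x ∷ es) (false ∷ E) e = chosen-noneChosen es E e

  chosen-nonempty : ∀ {N} (es : List (Pair N)) E → noneChosen E ≡ false → Σ (Pair N) λ z → z ∈ chosen es E
  chosen-nonempty []       []          ()
  chosen-nonempty (x ∷ es) (true ∷ E)  e = x , here Eq.refl
  chosen-nonempty (x ∷ es) (false ∷ E) e = chosen-nonempty es E e

module AttachedEdges where

  open import Defs using (Graph; n; adj; edges; attach; Kind; old; pv; pu; classify; kadj; next; _==_)
  open Basics
  open EdgeSelections using (Pair)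
  open import Data.Bool using (Bool; true; false; _∧_; if_then_else_)
  open import Data.Bool.Properties using (T?)
  open import Data.Nat using (ℕ; zero; suc; _+_; _≤_; _<_; _<ᵇ_; _≡ᵇ_)
  open import Data.Nat.Properties
  open import Data.Fin using (Fin; toℕ; _↑ˡ_; _↑ʳ_; splitAt; join)
  import Data.Fin as F
  open import Data.Fin.Properties
    using (toℕ<n; toℕ-inject₁; toℕ-↑ˡ; toℕ-↑ʳ; splitAt-↑ˡ; splitAt-↑ʳ; join-splitAt; toℕ-injective; ↑ˡ-injective)
  open import Data.List using (List; []; _∷_; map; _++_; concatMap; filterᵇ; cartesianProduct; allFin; tabulate)
  open import Data.List.Properties using (filter-++)
  open import Data.List.Membership.Propositional using (_∈_)
  open import Data.List.Membership.Propositional.Properties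
    using (∈-filter⁺; ∈-filter⁻; ∈-cartesianProduct⁺; ∈-allFin; ∈-map⁺; ∈-map⁻; ∈-++⁺ˡ; ∈-++⁺ʳ; ∈-++⁻)
  open import Data.List.Membership.Propositional.Properties.WithK using (unique∧set⇒bag)
  open import Data.List.Relation.Unary.Any using (here; there)
  open import Data.List.Relation.Unary.Unique.Propositional using (Unique)
  open import Data.List.Relation.Unary.Unique.Propositional.Properties
    using (filter⁺; cartesianProduct⁺; allFin⁺; map⁺; map⁻; ++⁺; tabulate⁺)
  open import Data.List.Relation.Binary.Permutation.Propositional using (_↭_)
  open import Data.List.Relation.Binary.Disjoint.Propositional using (Disjoint)
  open import Data.List.Relation.Binary.BagAndSetEquality using (∼bag⇒↭)
  open import Function.Bundles using (mk⇔)
  open import Data.Product using (Σ; _,_; proj₁; proj₂)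
  open import Data.Sum using (inj₁; inj₂)
  open import Data.Empty using (⊥-elim)
  open import Function using (_∘_)
  open import Relation.Binary.PropositionalEquality
  open import Relation.Nullary using (¬_)

  -- The edge list of G_{p,q} is, up to permutation, the edges of G (embedded)
  -- followed by the edges of the two attached paths.  Both lists are
  -- duplicate-free and have the same members, hence are permutations.

  isListedEdge : (K : Graph) → Pair (n K) → Bool
  isListedEdge K (i , j) = (toℕ i <ᵇ toℕ j) ∧ adj K i j

  edges-filter : ∀ K → edges K ≡ filterᵇ (isListedEdge K) (cartesianProduct (allFin (n K)) (allFin (n K)))
  edges-filter K = rows (allFin (n K)) (allFin (n K))
    where
    row : ∀ i (ys : List (Fin (n K))) →
      concatMap (λ j → if (toℕ i <ᵇ toℕ j) ∧ adj K i j then (i , j) ∷ [] else []) ys ≡ filterᵇ (isListedEdge K) (map (i ,_) ys)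
    row i [] = refl
    row i (y ∷ ys) with (toℕ i <ᵇ toℕ y) ∧ adj K i y
    ... | true  = cong ((i , y) ∷_) (row i ys)
    ... | false = row i ys
    rows : ∀ (xs ys : List (Fin (n K))) →
      concatMap (λ i → concatMap (λ j → if (toℕ i <ᵇ toℕ j) ∧ adj K i j then (i , j) ∷ [] else []) ys) xs
      ≡ filterᵇ (isListedEdge K) (cartesianProduct xs ys)
    rows []       ys = refl
    rows (x ∷ xs) ys = trans (cong₂ _++_ (row x ys) (rows xs ys))
      (sym (filter-++ (T? ∘ isListedEdge K) (map (x ,_) ys) (cartesianProduct xs ys)))

  edges-unique : ∀ K → Unique (edges K)
  edges-unique K = subst Unique (sym (edges-filter K))
    (filter⁺ (T? ∘ isListedEdge K) {xs = cartesianProduct (allFin (n K)) (allFin (n K))}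
             (cartesianProduct⁺ (allFin⁺ (n K)) (allFin⁺ (n K))))

  ∈edges⁻ : ∀ K {z} → z ∈ edges K → isListedEdge K z ≡ true
  ∈edges⁻ K m = T→≡ (proj₂ (∈-filter⁻ (T? ∘ isListedEdge K) {xs = cartesianProduct (allFin (n K)) (allFin (n K))}
                                        (subst (_ ∈_) (edges-filter K) m)))

  ∈edges⁺ : ∀ K {z} → isListedEdge K z ≡ true → z ∈ edges K
  ∈edges⁺ K {i , j} e = subst (_ ∈_) (sym (edges-filter K))
    (∈-filter⁺ (T? ∘ isListedEdge K) (∈-cartesianProduct⁺ (∈-allFin i) (∈-allFin j)) (≡→T e))

  pathEdges : ∀ {N} (m : ℕ) → Fin N → (Fin m → Fin N) → List (Pair N)
  pathEdges zero    r f = []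
  pathEdges (suc m) r f = (r , f F.zero) ∷ pathEdges m (f F.zero) (f ∘ F.suc)

  pathPrev : ∀ {N m} → Fin N → (Fin m → Fin N) → Fin m → Fin N
  pathPrev r f F.zero    = r
  pathPrev r f (F.suc i) = pathPrev (f F.zero) (f ∘ F.suc) i

  pathPrev-suc : ∀ {N m} (r : Fin N) (f : Fin (suc m) → Fin N) i → pathPrev r f (F.suc i) ≡ f (F.inject₁ i)
  pathPrev-suc r f F.zero    = refl
  pathPrev-suc r f (F.suc i) = pathPrev-suc (f F.zero) (f ∘ F.suc) i

  ∈pathEdges⁻ : ∀ {N} m (r : Fin N) f {z} → z ∈ pathEdges m r f → Σ (Fin m) λ i → z ≡ (pathPrev r f i , f i)
  ∈pathEdges⁻ (suc m) r f (here e) = F.zero , e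
  ∈pathEdges⁻ (suc m) r f (there x) with ∈pathEdges⁻ m (f F.zero) (f ∘ F.suc) x
  ... | i , e = F.suc i , e

  ∈pathEdges⁺ : ∀ {N} m (r : Fin N) f i → (pathPrev r f i , f i) ∈ pathEdges m r f
  ∈pathEdges⁺ (suc m) r f F.zero    = here refl
  ∈pathEdges⁺ (suc m) r f (F.suc i) = there (∈pathEdges⁺ m (f F.zero) (f ∘ F.suc) i)

  pathEdges-unique : ∀ {N} m (r : Fin N) f → (∀ {i j} → f i ≡ f j → i ≡ j) → Unique (pathEdges m r f)
  pathEdges-unique m r f inj = map⁻ (subst Unique (sym (second m r f)) (tabulate⁺ inj))
    where
    second : ∀ m (r : Fin _) f → map proj₂ (pathEdges m r f) ≡ tabulate f
    second zero    r f = refl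
    second (suc m) r f = cong (f F.zero ∷_) (second m (f F.zero) (f ∘ F.suc))

  next-prev : ∀ {N m} (r : Fin N) (f : Fin m → Fin N) (i j : Fin m) →
              toℕ i < toℕ j → next i j ≡ true → pathPrev r f j ≡ f i
  next-prev r f i j lt e with ∨-T {suc (toℕ i) ≡ᵇ toℕ j} e
  ... | inj₂ h = ⊥-elim (<-asym lt (subst (toℕ j <_) (≡ᵇ⇒≡ _ _ (≡→T h)) ≤-refl))
  next-prev r f i F.zero lt e | inj₁ h with ≡ᵇ⇒≡ (suc (toℕ i)) 0 (≡→T h)
  ... | ()
  next-prev r f i (F.suc j) lt e | inj₁ h =
    trans (pathPrev-suc r f j)
          (cong f (toℕ-injective (trans (toℕ-inject₁ j) (sym (suc-injective (≡ᵇ⇒≡ _ _ (≡→T h)))))))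

  -- The vertices of G_{p,q} = attach G v p q: o a for the vertices a of G,
  -- α i for v_{i+1} and β j for u_{j+1}.
  module Attached (G : Graph) (v : Fin (n G)) (p q : ℕ) where

    n₀ : ℕ
    n₀ = n G
    N : ℕ
    N = n₀ + (p + q)
    H : Graph
    H = attach G v p q

    o : Fin n₀ → Fin N
    o a = a ↑ˡ (p + q)
    α : Fin p → Fin N
    α i = n₀ ↑ʳ (i ↑ˡ q)
    β : Fin q → Fin N
    β j = n₀ ↑ʳ (p ↑ʳ j)

    cl-o : ∀ a → classify {n₀} {p} {q} (o a) ≡ old a
    cl-o a rewrite splitAt-↑ˡ n₀ a (p + q) = refl
    cl-α : ∀ i → classify {n₀} {p} {q} (α i) ≡ pv i
    cl-α i rewrite splitAt-↑ʳ n₀ (p + q) (i ↑ˡ q) | splitAt-↑ˡ p i q = refl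
    cl-β : ∀ j → classify {n₀} {p} {q} (β j) ≡ pu j
    cl-β j rewrite splitAt-↑ʳ n₀ (p + q) (p ↑ʳ j) | splitAt-↑ʳ p q j = refl

    data View : Fin N → Set where
      vo : ∀ a → View (o a)
      va : ∀ i → View (α i)
      vb : ∀ j → View (β j)

    rejoin : ∀ a b (x : Fin (a + b)) {s} → splitAt a x ≡ s → join a b s ≡ x
    rejoin a b x e = trans (cong (join a b) (sym e)) (join-splitAt a b x)

    view : ∀ x → View x
    view x with splitAt n₀ x in eq
    ... | inj₁ a = subst View (rejoin n₀ (p + q) x eq) (vo a)
    ... | inj₂ y with splitAt p y in eq₂
    ...   | inj₁ i = subst View (trans (cong (n₀ ↑ʳ_) (rejoin p q y eq₂)) (rejoin n₀ (p + q) x eq)) (va i)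
    ...   | inj₂ j = subst View (trans (cong (n₀ ↑ʳ_) (rejoin p q y eq₂)) (rejoin n₀ (p + q) x eq)) (vb j)

    toℕ-o : ∀ a → toℕ (o a) ≡ toℕ a
    toℕ-o a = toℕ-↑ˡ a (p + q)
    toℕ-α : ∀ i → toℕ (α i) ≡ n₀ + toℕ i
    toℕ-α i = trans (toℕ-↑ʳ n₀ (i ↑ˡ q)) (cong (n₀ +_) (toℕ-↑ˡ i q))
    toℕ-β : ∀ j → toℕ (β j) ≡ (n₀ + p) + toℕ j
    toℕ-β j = trans (toℕ-↑ʳ n₀ (p ↑ʳ j)) (trans (cong (n₀ +_) (toℕ-↑ʳ p j)) (sym (+-assoc n₀ p (toℕ j))))

    o-inj : ∀ {a b} → o a ≡ o b → a ≡ b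
    o-inj {a} {b} = ↑ˡ-injective (p + q) a b

    embG : Pair n₀ → Pair N
    embG (a , b) = (o a , o b)

    embG-inj : ∀ {z z'} → embG z ≡ embG z' → z ≡ z'
    embG-inj {a , b} {c , d} e = cong₂ _,_ (o-inj (cong proj₁ e)) (o-inj (cong proj₂ e))

    isEdgeH : Fin N → Fin N → Bool
    isEdgeH x y = (toℕ x <ᵇ toℕ y) ∧ kadj G v (classify {n₀} {p} {q} x) (classify {n₀} {p} {q} y)

    isEdgeH-intro : ∀ {x y} → toℕ x < toℕ y → kadj G v (classify {n₀} {p} {q} x) (classify {n₀} {p} {q} y) ≡ true →
                    isEdgeH x y ≡ true
    isEdgeH-intro lt k = ∧-i (T→≡ (<⇒<ᵇ lt)) k

    -- Both attached
    -- paths are instances (below), so their common facts are proved once.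
    module PendantPath (m : ℕ) (f : Fin m → Fin N) (K : Fin m → Kind n₀ p q) (c : ℕ)
      (cl-f : ∀ i → classify {n₀} {p} {q} (f i) ≡ K i) (toℕ-f : ∀ i → toℕ (f i) ≡ c + toℕ i) (n₀≤c : n₀ ≤ c)
      (kadj-root : ∀ a i → kadj G v (old a) (K i) ≡ (a == v) ∧ (toℕ i ≡ᵇ 0))
      (kadj-path : ∀ i j → kadj G v (K i) (K j) ≡ next i j) where

      f-inj : ∀ {i j} → f i ≡ f j → i ≡ j
      f-inj {i} {j} e = toℕ-injective (+-cancelˡ-≡ c _ _ (trans (sym (toℕ-f i)) (trans (cong toℕ e) (toℕ-f j))))

      o<f : ∀ a i → toℕ (o a) < toℕ (f i)
      o<f a i rewrite toℕ-o a | toℕ-f i = <-≤-trans (toℕ<n a) (≤-trans n₀≤c (m≤m+n c (toℕ i)))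

      o≢f : ∀ a i → ¬ (o a ≡ f i)
      o≢f a i e = <⇒≢ (o<f a i) (cong toℕ e)

      edges⇒isEdgeH : ∀ {z} → z ∈ pathEdges m (o v) f → isEdgeH (proj₁ z) (proj₂ z) ≡ true
      edges⇒isEdgeH e with ∈pathEdges⁻ m (o v) f e
      ... | F.zero , refl = isEdgeH-intro (o<f v F.zero) root
        where
        root : kadj G v (classify {n₀} {p} {q} (o v)) (classify {n₀} {p} {q} (f F.zero)) ≡ true
        root rewrite cl-o v | cl-f F.zero | kadj-root v F.zero = ∧-i (==-refl v) refl
      ... | F.suc i , refl rewrite pathPrev-suc (o v) f i = isEdgeH-intro lt link
        where
        lt : toℕ (f (F.inject₁ i)) < toℕ (f (F.suc i))
        lt rewrite toℕ-f (F.inject₁ i) | toℕ-f (F.suc i) | toℕ-inject₁ i = +-monoʳ-< c ≤-refl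
        link : kadj G v (classify {n₀} {p} {q} (f (F.inject₁ i))) (classify {n₀} {p} {q} (f (F.suc i))) ≡ true
        link rewrite cl-f (F.inject₁ i) | cl-f (F.suc i) | kadj-path (F.inject₁ i) (F.suc i) | toℕ-inject₁ i =
          ∨-l _ (T→≡ (≡⇒≡ᵇ (toℕ i) (toℕ i) refl))

      root-edge : ∀ a i → kadj G v (classify {n₀} {p} {q} (o a)) (classify {n₀} {p} {q} (f i)) ≡ true →
                  (o a , f i) ≡ (pathPrev (o v) f i , f i)
      root-edge a F.zero k rewrite cl-o a | cl-f F.zero | kadj-root a F.zero
        with ==-true {a = a} {v} (proj₁ (∧-T k))
      ... | refl = refl
      root-edge a (F.suc i) k rewrite cl-o a | cl-f (F.suc i) | kadj-root a (F.suc i)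
        with () ← proj₂ (∧-T {a == v} k)

      inner-edge : ∀ i j → toℕ (f i) < toℕ (f j) →
                   kadj G v (classify {n₀} {p} {q} (f i)) (classify {n₀} {p} {q} (f j)) ≡ true →
                   (f i , f j) ≡ (pathPrev (o v) f j , f j)
      inner-edge i j lt k rewrite cl-f i | cl-f j | kadj-path i j =
        cong (_, f j) (sym (next-prev (o v) f i j (+-cancelˡ-< c _ _ (subst₂ _<_ (toℕ-f i) (toℕ-f j) lt)) k))

    module Pα = PendantPath p α pv n₀ cl-α toℕ-α ≤-refl (λ _ _ → refl) (λ _ _ → refl)
    module Pβ = PendantPath q β pu (n₀ + p) cl-β toℕ-β (m≤m+n n₀ p) (λ _ _ → refl) (λ _ _ → refl)

    listedEdges : List (Pair N)
    listedEdges = map embG (edges G) ++ (pathEdges p (o v) α ++ pathEdges q (o v) β)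

    listed⇒isEdgeH : ∀ {z} → z ∈ listedEdges → isEdgeH (proj₁ z) (proj₂ z) ≡ true
    listed⇒isEdgeH m with ∈-++⁻ (map embG (edges G)) m
    ... | inj₂ m₂ with ∈-++⁻ (pathEdges p (o v) α) m₂
    ...   | inj₁ mα = Pα.edges⇒isEdgeH mα
    ...   | inj₂ mβ = Pβ.edges⇒isEdgeH mβ
    listed⇒isEdgeH m | inj₁ mG with ∈-map⁻ embG mG
    ... | (a , b) , m' , refl with ∧-T {toℕ a <ᵇ toℕ b} (∈edges⁻ G m')
    ... | lt , ad = isEdgeH-intro (subst₂ _<_ (sym (toℕ-o a)) (sym (toℕ-o b)) (<ᵇ⇒< _ _ (≡→T lt))) (old-edge ad)
      where
      old-edge : adj G a b ≡ true → kadj G v (classify {n₀} {p} {q} (o a)) (classify {n₀} {p} {q} (o b)) ≡ true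
      old-edge ad rewrite cl-o a | cl-o b = ad

    listedα : ∀ i → (pathPrev (o v) α i , α i) ∈ listedEdges
    listedα i = ∈-++⁺ʳ (map embG (edges G)) (∈-++⁺ˡ (∈pathEdges⁺ p (o v) α i))

    listedβ : ∀ i → (pathPrev (o v) β i , β i) ∈ listedEdges
    listedβ i = ∈-++⁺ʳ (map embG (edges G)) (∈-++⁺ʳ (pathEdges p (o v) α) (∈pathEdges⁺ q (o v) β i))

    isEdgeH⇒listed : ∀ x y → isEdgeH x y ≡ true → (x , y) ∈ listedEdges
    isEdgeH⇒listed x y e with ∧-T {toℕ x <ᵇ toℕ y} e
    ... | lt , k = byView (view x) (view y) (<ᵇ⇒< _ _ (≡→T lt)) k
      where
      byView : ∀ {x y} → View x → View y → toℕ x < toℕ y →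
               kadj G v (classify {n₀} {p} {q} x) (classify {n₀} {p} {q} y) ≡ true → (x , y) ∈ listedEdges
      byView (vo a) (vo b) lt k rewrite cl-o a | cl-o b =
        ∈-++⁺ˡ (∈-map⁺ embG (∈edges⁺ G {a , b} (∧-i (T→≡ (<⇒<ᵇ (subst₂ _<_ (toℕ-o a) (toℕ-o b) lt))) k)))
      byView (vo a) (va i) lt k = subst (_∈ listedEdges) (sym (Pα.root-edge a i k)) (listedα i)
      byView (vo a) (vb j) lt k = subst (_∈ listedEdges) (sym (Pβ.root-edge a j k)) (listedβ j)
      byView (va i) (va j) lt k = subst (_∈ listedEdges) (sym (Pα.inner-edge i j lt k)) (listedα j)
      byView (vb i) (vb j) lt k = subst (_∈ listedEdges) (sym (Pβ.inner-edge i j lt k)) (listedβ j)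
      byView (va i) (vo a) lt k = ⊥-elim (<-asym lt (Pα.o<f a i))
      byView (vb j) (vo a) lt k = ⊥-elim (<-asym lt (Pβ.o<f a j))
      byView (va i) (vb j) lt k rewrite cl-α i | cl-β j with () ← k
      byView (vb j) (va i) lt k rewrite cl-α i | cl-β j with () ← k

    α≢β : ∀ i j → ¬ (α i ≡ β j)
    α≢β i j e = <⇒≢ lt (trans (sym (toℕ-α i)) (trans (cong toℕ e) (toℕ-β j)))
      where
      lt : n₀ + toℕ i < (n₀ + p) + toℕ j
      lt = <-≤-trans (+-monoʳ-< n₀ (toℕ<n i)) (m≤m+n (n₀ + p) (toℕ j))

    listedEdges-unique : Unique listedEdges
    listedEdges-unique =
      ++⁺ (map⁺ embG-inj (edges-unique G))
          (++⁺ (pathEdges-unique p (o v) α Pα.f-inj) (pathEdges-unique q (o v) β Pβ.f-inj) paths-disjoint)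
          old-new-disjoint
      where
      paths-disjoint : Disjoint (pathEdges p (o v) α) (pathEdges q (o v) β)
      paths-disjoint (mα , mβ) with ∈pathEdges⁻ p (o v) α mα | ∈pathEdges⁻ q (o v) β mβ
      ... | i , refl | j , e = α≢β i j (cong proj₂ e)
      old-new-disjoint : Disjoint (map embG (edges G)) (pathEdges p (o v) α ++ pathEdges q (o v) β)
      old-new-disjoint (mG , m) with ∈-map⁻ embG mG
      ... | (a , b) , _ , refl with ∈-++⁻ (pathEdges p (o v) α) m
      ...   | inj₁ mα = Pα.o≢f b (proj₁ (∈pathEdges⁻ p (o v) α mα)) (cong proj₂ (proj₂ (∈pathEdges⁻ p (o v) α mα)))
      ...   | inj₂ mβ = Pβ.o≢f b (proj₁ (∈pathEdges⁻ q (o v) β mβ)) (cong proj₂ (proj₂ (∈pathEdges⁻ q (o v) β mβ)))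

    edges-attach↭listed : edges H ↭ listedEdges
    edges-attach↭listed = ∼bag⇒↭ (unique∧set⇒bag (edges-unique H) listedEdges-unique (mk⇔ to from))
      where
      to : ∀ {z} → z ∈ edges H → z ∈ listedEdges
      to {x , y} m = isEdgeH⇒listed x y (∈edges⁻ H m)
      from : ∀ {z} → z ∈ listedEdges → z ∈ edges H
      from {x , y} m = ∈edges⁺ H (listed⇒isEdgeH m)

module PendantPaths where

  open Basics
  open Walks
  open VectorSums
  open EdgeSelections
  open AttachedEdges using (pathEdges; pathPrev; pathPrev-suc)
  open import Data.Bool using (Bool; true; false; _∧_; _∨_; not; if_then_else_; T)
  open import Data.Nat using (ℕ; zero; suc; _+_; _≤_; _<_; _<ᵇ_; z≤n; s≤s)
  open import Data.Nat.Properties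
  open import Data.Fin using (Fin; toℕ)
  import Data.Fin as F
  open import Data.Fin.Properties using (toℕ-inject₁; toℕ-injective)
  open import Data.Vec using (Vec; []; _∷_; lookup)
  open import Data.List using (List; []; _∷_; length)
  open import Data.List.Membership.Propositional using (_∈_)
  open import Data.List.Relation.Unary.Any using (here; there)
  open import Data.Product using (Σ; _×_; _,_; proj₁; proj₂)
  open import Data.Sum using (_⊎_; inj₁; inj₂)
  open import Data.Empty using (⊥-elim)
  open import Function using (_∘_)
  open import Relation.Binary.PropositionalEquality

  -- A selection of path vertices Sa
  -- and path edges Ea (bit i of Ea = the edge into f i) can be part of a
  -- connected subgraph in only two ways:
  --   * 'rooted rb Sa Ea' (rb the bit of r): the selected vertices are an initial segment
  --     f₀ … f_{t-1}, nonempty only if rb, and Ea = Sa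
  --     (m + 1 possibilities when r is selected, 1 otherwise);
  --   * 'floating Sa Ea': r is not selected and the selected vertices are a
  --     nonempty segment f_s … f_{t-1} with exactly its inner edges chosen
  --     (m(m+1)/2 possibilities); then the subgraph lies inside the path.

  sameBool : Bool → Bool → Bool
  sameBool true  b = b
  sameBool false b = not b

  sameBool-refl : ∀ b → sameBool b b ≡ true
  sameBool-refl true  = refl
  sameBool-refl false = refl

  sameBool-≡ : ∀ {a b} → sameBool a b ≡ true → a ≡ b
  sameBool-≡ {true}  {true}  _ = refl
  sameBool-≡ {false} {false} _ = refl

  chosenPath : ∀ {N} m (r : Fin N) (f : Fin m → Fin N) → Vec Bool m → List (Pair N)
  chosenPath zero r f [] = []
  chosenPath (suc m) r f (c ∷ cs) =
    if c then (r , f F.zero) ∷ chosenPath m (f F.zero) (f ∘ F.suc) cs else chosenPath m (f F.zero) (f ∘ F.suc) cs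

  sumChosen-path : ∀ {N} m (r : Fin N) f (Ψ : List (Pair N) → ℕ) →
    sumAll (length (pathEdges m r f)) (λ E → Ψ (chosen (pathEdges m r f) E)) ≡ sumAll m (λ E → Ψ (chosenPath m r f E))
  sumChosen-path zero r f Ψ = refl
  sumChosen-path (suc m) r f Ψ = sumChosen-path m (f F.zero) (f ∘ F.suc) (λ c → Ψ ((r , f F.zero) ∷ c) + Ψ c)

  ∈chosenPath⁻ : ∀ {N} m (r : Fin N) f E {z} → z ∈ chosenPath m r f E →
    Σ (Fin m) λ j → lookup E j ≡ true × z ≡ (pathPrev r f j , f j)
  ∈chosenPath⁻ zero r f [] ()
  ∈chosenPath⁻ (suc m) r f (true ∷ E) (here e) = F.zero , refl , e
  ∈chosenPath⁻ (suc m) r f (true ∷ E) (there x) with ∈chosenPath⁻ m _ _ E x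
  ... | j , ej , e = F.suc j , ej , e
  ∈chosenPath⁻ (suc m) r f (false ∷ E) x with ∈chosenPath⁻ m _ _ E x
  ... | j , ej , e = F.suc j , ej , e

  ∈chosenPath⁺ : ∀ {N} m (r : Fin N) f E j → lookup E j ≡ true → (pathPrev r f j , f j) ∈ chosenPath m r f E
  ∈chosenPath⁺ (suc m) r f (true ∷ E) F.zero e = here refl
  ∈chosenPath⁺ (suc m) r f (true ∷ E) (F.suc j) e = there (∈chosenPath⁺ m _ _ E j e)
  ∈chosenPath⁺ (suc m) r f (false ∷ E) (F.suc j) e = ∈chosenPath⁺ m _ _ E j e

  chosenPath-tail : ∀ {N} m (r : Fin N) (f : Fin (suc m) → Fin N) c E {z} →
    z ∈ chosenPath m (f F.zero) (f ∘ F.suc) E → z ∈ chosenPath (suc m) r f (c ∷ E)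
  chosenPath-tail m r f true E x = there x
  chosenPath-tail m r f false E x = x

  prevBit : ∀ {m} → Bool → Vec Bool m → Fin m → Bool
  prevBit r (s ∷ S) F.zero = r
  prevBit r (s ∷ S) (F.suc i) = prevBit s S i

  prevBit-lookup : ∀ {N} (S : Vec Bool N) m (r : Fin N) f (Sa : Vec Bool m) rb → lookup S r ≡ rb →
    (∀ i → lookup S (f i) ≡ lookup Sa i) → ∀ i → lookup S (pathPrev r f i) ≡ prevBit rb Sa i
  prevBit-lookup S (suc m) r f (s ∷ Sa) rb e h F.zero = e
  prevBit-lookup S (suc m) r f (s ∷ Sa) rb e h (F.suc i) =
    prevBit-lookup S m (f F.zero) (f ∘ F.suc) Sa s (h F.zero) (λ j → h (F.suc j)) i

  rooted : ∀ {m} → Bool → Vec Bool m → Vec Bool m → Bool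
  rooted r [] [] = true
  rooted r (s ∷ S) (e ∷ E) = sameBool e s ∧ (not s ∨ r) ∧ rooted s S E

  rooted-char⁺ : ∀ {m} rb (Sa E : Vec Bool m) → (∀ i → lookup E i ≡ lookup Sa i) →
    (∀ i → lookup Sa i ≡ true → prevBit rb Sa i ≡ true) → rooted rb Sa E ≡ true
  rooted-char⁺ rb [] [] h1 h2 = refl
  rooted-char⁺ rb (s ∷ Sa) (e ∷ E) h1 h2 =
    ∧-i (subst (λ t → sameBool t s ≡ true) (sym (h1 F.zero)) (sameBool-refl s))
      (∧-i (⇒ᵇ-intro s (h2 F.zero)) (rooted-char⁺ s Sa E (λ i → h1 (F.suc i)) (λ i → h2 (F.suc i))))

  rooted-char⁻ : ∀ {m} rb (Sa E : Vec Bool m) → rooted rb Sa E ≡ true →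
    (∀ i → lookup E i ≡ lookup Sa i) × (∀ i → lookup Sa i ≡ true → prevBit rb Sa i ≡ true)
  rooted-char⁻ rb [] [] h = (λ ()) , (λ ())
  rooted-char⁻ rb (s ∷ Sa) (e ∷ E) h with ∧-T {sameBool e s} h
  ... | h1 , h23 with ∧-T {not s ∨ rb} h23
  ... | h2 , h3 with rooted-char⁻ s Sa E h3
  ... | k1 , k2 = (λ { F.zero → sameBool-≡ h1 ; (F.suc i) → k1 i }) ,
                  (λ { F.zero e' → ⇒ᵇ-elim s h2 e' ; (F.suc i) e' → k2 i e' })

  rooted-root : ∀ {m} rb (Sa E : Vec Bool m) → rooted rb Sa E ≡ true → ∀ i → lookup Sa i ≡ true → rb ≡ true
  rooted-root rb (s ∷ Sa) (e ∷ E) h i si with ∧-T {sameBool e s} h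
  ... | h1 , h23 with ∧-T {not s ∨ rb} h23
  ... | h2 , h3 = ⇒ᵇ-elim s h2 (first-selected i si)
    where
    first-selected : ∀ i → lookup (s ∷ Sa) i ≡ true → s ≡ true
    first-selected F.zero    x = x
    first-selected (F.suc i) x = rooted-root s Sa E h3 i x

  rooted-false : ∀ {m} (Sa E : Vec Bool m) → rooted false Sa E ≡ true → ∀ i → lookup Sa i ≡ false
  rooted-false Sa E h i with lookup Sa i in eq
  ... | false = refl
  ... | true = ⊥-elim (t≢f (sym (rooted-root false Sa E h i eq)))

  rooted-false-E : ∀ {m} (Sa E : Vec Bool m) → rooted false Sa E ≡ true → ∀ i → lookup E i ≡ false
  rooted-false-E Sa E h i = trans (proj₁ (rooted-char⁻ false Sa E h) i) (rooted-false Sa E h i)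

  floating : ∀ {m} → Vec Bool m → Vec Bool m → Bool
  floating [] [] = false
  floating (s ∷ S) (e ∷ E) = not e ∧ (if s then rooted true S E else floating S E)

  floating-from : ∀ {m} (Sa E : Vec Bool m) → (Σ (Fin m) λ i → lookup Sa i ≡ true) →
    (∀ i → lookup E i ≡ true → prevBit false Sa i ≡ true × lookup Sa i ≡ true) →
    (∀ i j → toℕ j < toℕ i → lookup Sa j ≡ true → lookup Sa i ≡ true → lookup E i ≡ true) →
    floating Sa E ≡ true
  floating-from [] [] (() , _) h1 h2
  floating-from (s ∷ Sa) (e ∷ E) h0 h1 h2 = ∧-i (ne e (h1 F.zero)) (rest s h0 h1 h2)
    where
    ne : ∀ e → (e ≡ true → false ≡ true × s ≡ true) → not e ≡ true
    ne false _ = refl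
    ne true h = ⊥-elim (t≢f (sym (proj₁ (h refl))))
    rest : ∀ s → (Σ (Fin _) λ i → lookup (s ∷ Sa) i ≡ true) →
      (∀ i → lookup (e ∷ E) i ≡ true → prevBit false (s ∷ Sa) i ≡ true × lookup (s ∷ Sa) i ≡ true) →
      (∀ i j → toℕ j < toℕ i → lookup (s ∷ Sa) j ≡ true → lookup (s ∷ Sa) i ≡ true → lookup (e ∷ E) i ≡ true) →
      (if s then rooted true Sa E else floating Sa E) ≡ true
    rest true h0 h1 h2 = rooted-char⁺ true Sa E
      (λ i → bool-ext (λ x → proj₂ (h1 (F.suc i) x)) (λ x → h2 (F.suc i) F.zero (s≤s z≤n) refl x))
      (λ i x → proj₁ (h1 (F.suc i) (h2 (F.suc i) F.zero (s≤s z≤n) refl x)))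
    rest false (F.zero , ()) h1 h2
    rest false (F.suc i , x) h1 h2 = floating-from Sa E (i , x) (λ j → h1 (F.suc j)) (λ i j lt → h2 (F.suc i) (F.suc j) (s≤s lt))

  floating-ends : ∀ {m} (Sa E : Vec Bool m) → floating Sa E ≡ true → ∀ i → lookup E i ≡ true →
    prevBit false Sa i ≡ true × lookup Sa i ≡ true
  floating-ends (s ∷ Sa) (e ∷ E) h i x with ∧-T {not e} h
  floating-ends (s ∷ Sa) (true ∷ E) h F.zero x | () , _
  floating-ends (s ∷ Sa) (false ∷ E) h F.zero () | _
  floating-ends (true ∷ Sa) (e ∷ E) h (F.suc i) x | _ , h2 with rooted-char⁻ true Sa E h2
  ... | k1 , k2 = k2 i (trans (sym (k1 i)) x) , trans (sym (k1 i)) x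
  floating-ends (false ∷ Sa) (e ∷ E) h (F.suc i) x | _ , h2 = floating-ends Sa E h2 i x

  floating-nonempty : ∀ {m} (S E : Vec Bool m) → floating S E ≡ true → Σ (Fin m) λ h → lookup S h ≡ true
  floating-nonempty []          []      ()
  floating-nonempty (true ∷ S)  (e ∷ E) h = F.zero , refl
  floating-nonempty (false ∷ S) (e ∷ E) h with floating-nonempty S E (proj₂ (∧-T {not e} h))
  ... | i , x = F.suc i , x

  module PathReach {N} (cl : List (Pair N)) where
    edge0 : ∀ m (r : Fin N) (f : Fin (suc m) → Fin N) E →
      (∀ {z} → z ∈ chosenPath (suc m) r f (true ∷ E) → z ∈ cl) → Reach (adjL cl) (f F.zero) r
    edge0 m r f E sub = step (adjL-intro (f F.zero) r (sub (here refl)) (inj₂ (refl , refl))) stay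

    rooted-reach : ∀ m (r : Fin N) f (Sa E : Vec Bool m) rb → (∀ {z} → z ∈ chosenPath m r f E → z ∈ cl) →
      rooted rb Sa E ≡ true → ∀ i → lookup Sa i ≡ true → Reach (adjL cl) (f i) r
    rooted-reach (suc m) r f (s ∷ Sa) (e ∷ E) rb sub h i si with ∧-T {sameBool e s} h
    ... | h1 , h23 with ∧-T {not s ∨ rb} h23
    ... | h2 , h3 = go i si
      where
      s-true : s ≡ true → Reach (adjL cl) (f F.zero) r
      s-true refl with sameBool-≡ {e} h1
      ... | refl = edge0 m r f E sub
      go : ∀ i → lookup (s ∷ Sa) i ≡ true → Reach (adjL cl) (f i) r
      go F.zero x = s-true x
      go (F.suc i) x = Reach-trans (rooted-reach m (f F.zero) (f ∘ F.suc) Sa E s (λ z → sub (chosenPath-tail m r f e E z)) h3 i x)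
                                   (s-true (rooted-root s Sa E h3 i x))

    floating-reach : ∀ m (r : Fin N) f (Sa E : Vec Bool m) → (∀ {z} → z ∈ chosenPath m r f E → z ∈ cl) →
      floating Sa E ≡ true → Σ (Fin m) λ h → lookup Sa h ≡ true × (∀ t → lookup Sa t ≡ true → Reach (adjL cl) (f t) (f h))
    floating-reach zero r f [] [] sub ()
    floating-reach (suc m) r f (true ∷ Sa) (e ∷ E) sub h with ∧-T {not e} h
    ... | _ , h2 = F.zero , refl , λ { F.zero _ → stay
                                    ; (F.suc t) x → rooted-reach m (f F.zero) (f ∘ F.suc) Sa E true
                                          (λ z → sub (chosenPath-tail m r f e E z)) h2 t x }
    floating-reach (suc m) r f (false ∷ Sa) (e ∷ E) sub h with ∧-T {not e} h
    ... | _ , h2 with floating-reach m (f F.zero) (f ∘ F.suc) Sa E (λ z → sub (chosenPath-tail m r f e E z)) h2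
    ... | hh , x , k = F.suc hh , x , λ { F.zero () ; (F.suc t) y → k t y }

  -- Index the path vertices by 'idx' (r ↦ 0,
  -- f i ↦ i + 1) and assume every edge of cl lies at index 0 or is a chosen
  -- path edge.  Then a walk from an index above k to an index at most k must
  -- use the path edge into f k, which is therefore chosen ('cross').  For a
  -- connected subgraph this yields the rooted, resp. floating, pattern.
  module PathCut {N} (cl : List (Pair N)) (m : ℕ) (r : Fin N) (f : Fin m → Fin N) (Ea : Vec Bool m) (idx : Fin N → ℕ)
     (idx-r : idx r ≡ 0) (idx-f : ∀ i → idx (f i) ≡ suc (toℕ i))
     (hyp : ∀ a b → adjL cl a b ≡ true → (idx a ≡ 0 × idx b ≡ 0) ⊎
            Σ (Fin m) λ j → lookup Ea j ≡ true × Joins (pathPrev r f j , f j) a b) where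

    idx-prev : ∀ j → idx (pathPrev r f j) ≡ toℕ j
    idx-prev F.zero = idx-r
    idx-prev (F.suc j) = trans (cong idx (pathPrev-suc r f j)) (trans (idx-f (F.inject₁ j)) (cong suc (toℕ-inject₁ j)))

    <ᵇ-false : ∀ {a b} → b ≤ a → (a <ᵇ b) ≡ false
    <ᵇ-false {a} {b} le with a <ᵇ b in eq
    ... | false = refl
    ... | true = ⊥-elim (<⇒≱ (<ᵇ⇒< a b (≡→T eq)) le)

    ≥-of : ∀ {a b} → (a <ᵇ b) ≡ false → b ≤ a
    ≥-of {a} {b} e = ≮⇒≥ (λ lt → subst T e (<⇒<ᵇ lt))

    cross : ∀ (k : Fin m) {x y} → Reach (adjL cl) x y → toℕ k < idx x → idx y ≤ toℕ k → lookup Ea k ≡ true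
    cross k R lt le with cut (λ z → toℕ k <ᵇ idx z) R (T→≡ (<⇒<ᵇ lt)) (<ᵇ-false le)
    ... | a , b , Ua , Ub , ad with hyp a b ad
    ... | inj₁ (ia , ib) = ⊥-elim (<⇒≱ (subst (toℕ k <_) ia (<ᵇ⇒< _ _ (≡→T Ua))) z≤n)
    ... | inj₂ (j , ej , inj₁ (refl , refl)) =
          ⊥-elim (<⇒≱ (subst (toℕ k <_) (idx-prev j) (<ᵇ⇒< _ _ (≡→T Ua)))
                      (≤-trans (n≤1+n (toℕ j)) (subst (_≤ toℕ k) (idx-f j) (≥-of Ub))))
    ... | inj₂ (j , ej , inj₂ (refl , refl)) = subst (λ t → lookup Ea t ≡ true) (sym k≡j) ej
      where
      k≡j : k ≡ j
      k≡j = toℕ-injective (≤-antisym (≤-pred (subst (toℕ k <_) (idx-f j) (<ᵇ⇒< _ _ (≡→T Ua))))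
                                     (subst (_≤ toℕ k) (idx-prev j) (≥-of Ub)))

    module OnPath (S : Vec Bool N) (Sa : Vec Bool m) (lookS : ∀ i → lookup S (f i) ≡ lookup Sa i)
                    (sub : ∀ {z} → z ∈ chosenPath m r f Ea → z ∈ cl) where

      ends : ConnSub N S cl → ∀ j → lookup Ea j ≡ true → lookup S (pathPrev r f j) ≡ true × lookup Sa j ≡ true
      ends C j e with allIn-∈ {S = S} (proj₁ (proj₂ C)) (sub (∈chosenPath⁺ m r f Ea j e))
      ... | a , b = a , trans (sym (lookS j)) b

      reachC : ConnSub N S cl → ∀ {x y} → lookup S x ≡ true → lookup S y ≡ true → Reach (adjL cl) x y
      reachC C {x} {y} sx sy = proj₂ (proj₂ C) x y sx sy

      rooted-of-conn : ConnSub N S cl → (Σ (Fin N) λ x → lookup S x ≡ true × idx x ≡ 0) → rooted (lookup S r) Sa Ea ≡ true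
      rooted-of-conn C (x , sx , ix) = rooted-char⁺ (lookup S r) Sa Ea
          (λ i → bool-ext (λ e → proj₂ (ends C i e)) (λ s → toE i s))
          (λ i s → trans (sym (prevBit-lookup S m r f Sa (lookup S r) refl lookS i)) (proj₁ (ends C i (toE i s))))
        where
        toE : ∀ i → lookup Sa i ≡ true → lookup Ea i ≡ true
        toE i s = cross i (reachC C (trans (lookS i) s) sx) (subst (toℕ i <_) (sym (idx-f i)) ≤-refl)
                          (subst (_≤ toℕ i) (sym ix) z≤n)

      floating-of-conn : ConnSub N S cl → lookup S r ≡ false → (Σ (Fin m) λ i → lookup Sa i ≡ true) → floating Sa Ea ≡ true
      floating-of-conn C r∉S w = floating-from Sa Ea w
        (λ i e → trans (sym (prevBit-lookup S m r f Sa false r∉S lookS i)) (proj₁ (ends C i e)) , proj₂ (ends C i e))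
        (λ i j lt sj si → cross i (reachC C (trans (lookS i) si) (trans (lookS j) sj))
                             (subst (toℕ i <_) (sym (idx-f i)) ≤-refl) (subst (_≤ toℕ i) (sym (idx-f j)) lt))

module Decomposition where

  open import Defs using (Graph; n; edges; anyF; Kind; old; pv; pu; classify)
  open Basics
  open Walks
  open EdgeSelections
  open AttachedEdges
  open PendantPaths
  open import Data.Bool using (Bool; true; false; _∧_; _∨_; if_then_else_)
  open import Data.Nat using (ℕ; suc)
  open import Data.Fin using (Fin; toℕ)
  import Data.Fin as F
  open import Data.Vec using (Vec; lookup; _++_)
  open import Data.Vec.Properties using (lookup-++ˡ; lookup-++ʳ)
  open import Data.List using (List; map)
  import Data.List as L
  open import Data.List.Membership.Propositional using (_∈_)
  open import Data.List.Membership.Propositional.Properties using (∈-map⁺; ∈-map⁻; ∈-++⁺ˡ; ∈-++⁺ʳ; ∈-++⁻)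
  open import Data.Product using (Σ; _×_; _,_; proj₁; proj₂)
  open import Data.Sum using (_⊎_; inj₁; inj₂)
  open import Data.Empty using (⊥-elim)
  open import Relation.Binary.PropositionalEquality

  -- Write a
  -- vertex subset of H as So ++ Sa ++ Sb (old vertices, first path, second
  -- path) and an edge subset, after reordering, as EG ++ Ea ++ Eb.  Then
  -- (S, E) is a connected subgraph of H iff
  --   * So ≠ ∅:  (So, EG) is a connected subgraph of G and both path parts
  --     are rooted at v (nonempty only if v ∈ So); or
  --   * So = ∅:  EG = ∅ and one path part is floating, the other empty.

  module Projections (G : Graph) (v : Fin (n G)) (p q : ℕ) where
    open Attached G v p q

    idxK idxKb : Kind n₀ p q → ℕ
    idxK (pv j) = suc (toℕ j)
    idxK _      = 0
    idxKb (pu j) = suc (toℕ j)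
    idxKb _      = 0
    πK : Kind n₀ p q → Fin n₀
    πK (old a) = a
    πK _       = v

    idxA idxB : Fin N → ℕ
    idxA x = idxK (classify {n₀} {p} {q} x)
    idxB x = idxKb (classify {n₀} {p} {q} x)
    π : Fin N → Fin n₀
    π x = πK (classify {n₀} {p} {q} x)

    idxA-o : ∀ a → idxA (o a) ≡ 0
    idxA-o a rewrite cl-o a = refl
    idxA-α : ∀ i → idxA (α i) ≡ suc (toℕ i)
    idxA-α i rewrite cl-α i = refl
    idxA-β : ∀ i → idxA (β i) ≡ 0
    idxA-β i rewrite cl-β i = refl
    idxB-o : ∀ a → idxB (o a) ≡ 0
    idxB-o a rewrite cl-o a = refl
    idxB-α : ∀ i → idxB (α i) ≡ 0
    idxB-α i rewrite cl-α i = refl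
    idxB-β : ∀ i → idxB (β i) ≡ suc (toℕ i)
    idxB-β i rewrite cl-β i = refl
    π-o : ∀ a → π (o a) ≡ a
    π-o a rewrite cl-o a = refl
    π-α : ∀ i → π (α i) ≡ v
    π-α i rewrite cl-α i = refl
    π-β : ∀ i → π (β i) ≡ v
    π-β i rewrite cl-β i = refl

    idxA-pb : ∀ j → idxA (pathPrev (o v) β j) ≡ 0
    idxA-pb F.zero    = idxA-o v
    idxA-pb (F.suc j) rewrite pathPrev-suc (o v) β j = idxA-β _
    idxB-pa : ∀ j → idxB (pathPrev (o v) α j) ≡ 0
    idxB-pa F.zero    = idxB-o v
    idxB-pa (F.suc j) rewrite pathPrev-suc (o v) α j = idxB-α _
    π-pa : ∀ j → π (pathPrev (o v) α j) ≡ v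
    π-pa F.zero    = π-o v
    π-pa (F.suc j) rewrite pathPrev-suc (o v) α j = π-α _
    π-pb : ∀ j → π (pathPrev (o v) β j) ≡ v
    π-pb F.zero    = π-o v
    π-pb (F.suc j) rewrite pathPrev-suc (o v) β j = π-β _

    data SideView {m m'} (f : Fin m → Fin N) (f' : Fin m' → Fin N) : Fin N → Set where
      at-old  : ∀ a → SideView f f' (o a)
      on-this : ∀ i → SideView f f' (f i)
      on-that : ∀ j → SideView f f' (f' j)

    viewα : ∀ x → SideView α β x
    viewα x with view x
    ... | vo a = at-old a
    ... | va i = on-this i
    ... | vb j = on-that j

    viewβ : ∀ x → SideView β α x
    viewβ x with view x
    ... | vo a = at-old a
    ... | va i = on-that i
    ... | vb j = on-this j

    module Selection (So : Vec Bool n₀) (Sa : Vec Bool p) (Sb : Vec Bool q)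
                     (EG : Vec Bool (L.length (edges G))) (Ea : Vec Bool p) (Eb : Vec Bool q) where

      S : Vec Bool N
      S = So ++ (Sa ++ Sb)
      cG : List (Pair n₀)
      cG = chosen (edges G) EG
      clA clB : List (Pair N)
      clA = chosenPath p (o v) α Ea
      clB = chosenPath q (o v) β Eb
      cl : List (Pair N)
      cl = map embG cG L.++ (clA L.++ clB)

      lookS-o : ∀ a → lookup S (o a) ≡ lookup So a
      lookS-o a = lookup-++ˡ So (Sa ++ Sb) a
      lookS-α : ∀ i → lookup S (α i) ≡ lookup Sa i
      lookS-α i = trans (lookup-++ʳ So (Sa ++ Sb) (i F.↑ˡ q)) (lookup-++ˡ Sa Sb i)
      lookS-β : ∀ i → lookup S (β i) ≡ lookup Sb i
      lookS-β i = trans (lookup-++ʳ So (Sa ++ Sb) (p F.↑ʳ i)) (lookup-++ʳ Sa Sb i)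

      subA : ∀ {z} → z ∈ clA → z ∈ cl
      subA z∈ = ∈-++⁺ʳ (map embG cG) (∈-++⁺ˡ z∈)
      subB : ∀ {z} → z ∈ clB → z ∈ cl
      subB z∈ = ∈-++⁺ʳ (map embG cG) (∈-++⁺ʳ clA z∈)
      subG : ∀ {z} → z ∈ cG → embG z ∈ cl
      subG z∈ = ∈-++⁺ˡ (∈-map⁺ embG z∈)

      data EdgeKind (a b : Fin N) : Set where
        eG : ∀ c d → (c , d) ∈ cG → Joins (o c , o d) a b → EdgeKind a b
        eA : ∀ j → lookup Ea j ≡ true → Joins (pathPrev (o v) α j , α j) a b → EdgeKind a b
        eB : ∀ j → lookup Eb j ≡ true → Joins (pathPrev (o v) β j , β j) a b → EdgeKind a b

      edgeKind : ∀ a b → adjL cl a b ≡ true → EdgeKind a b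
      edgeKind a b e with adjL-∈ cl a b e
      ... | z , z∈ , joins with ∈-++⁻ (map embG cG) z∈
      ...   | inj₁ zG with ∈-map⁻ embG zG
      ...     | (c , d) , cd∈ , refl = eG c d cd∈ joins
      edgeKind a b e | z , z∈ , joins | inj₂ z' with ∈-++⁻ clA z'
      ...   | inj₁ zA with ∈chosenPath⁻ p (o v) α Ea zA
      ...     | j , ej , refl = eA j ej joins
      edgeKind a b e | z , z∈ , joins | inj₂ z' | inj₂ zB with ∈chosenPath⁻ q (o v) β Eb zB
      ...     | j , ej , refl = eB j ej joins

      offA : ∀ a b → adjL cl a b ≡ true → (idxA a ≡ 0 × idxA b ≡ 0) ⊎
             Σ (Fin p) λ j → lookup Ea j ≡ true × Joins (pathPrev (o v) α j , α j) a b
      offA a b e with edgeKind a b e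
      ... | eG c d _ (inj₁ (refl , refl)) = inj₁ (idxA-o c , idxA-o d)
      ... | eG c d _ (inj₂ (refl , refl)) = inj₁ (idxA-o d , idxA-o c)
      ... | eA j ej joins = inj₂ (j , ej , joins)
      ... | eB j ej (inj₁ (refl , refl)) = inj₁ (idxA-pb j , idxA-β j)
      ... | eB j ej (inj₂ (refl , refl)) = inj₁ (idxA-β j , idxA-pb j)

      offB : ∀ a b → adjL cl a b ≡ true → (idxB a ≡ 0 × idxB b ≡ 0) ⊎
             Σ (Fin q) λ j → lookup Eb j ≡ true × Joins (pathPrev (o v) β j , β j) a b
      offB a b e with edgeKind a b e
      ... | eG c d _ (inj₁ (refl , refl)) = inj₁ (idxB-o c , idxB-o d)
      ... | eG c d _ (inj₂ (refl , refl)) = inj₁ (idxB-o d , idxB-o c)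
      ... | eB j ej joins = inj₂ (j , ej , joins)
      ... | eA j ej (inj₁ (refl , refl)) = inj₁ (idxB-pa j , idxB-α j)
      ... | eA j ej (inj₂ (refl , refl)) = inj₁ (idxB-α j , idxB-pa j)

      module CA = PathCut cl p (o v) α Ea idxA (idxA-o v) idxA-α offA
      module CB = PathCut cl q (o v) β Eb idxB (idxB-o v) idxB-β offB
      module SA = CA.OnPath S Sa lookS-α subA
      module SB = CB.OnPath S Sb lookS-β subB

      π-step : ∀ a b → adjL cl a b ≡ true → π a ≡ π b ⊎ adjL cG (π a) (π b) ≡ true
      π-step a b e with edgeKind a b e
      ... | eG c d cd∈ (inj₁ (refl , refl)) =
            inj₂ (subst₂ (λ x y → adjL cG x y ≡ true) (sym (π-o c)) (sym (π-o d)) (∈-adjL cd∈))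
      ... | eG c d cd∈ (inj₂ (refl , refl)) =
            inj₂ (subst₂ (λ x y → adjL cG x y ≡ true) (sym (π-o d)) (sym (π-o c)) (trans (adjL-sym cG d c) (∈-adjL cd∈)))
      ... | eA j _ (inj₁ (refl , refl)) = inj₁ (trans (π-pa j) (sym (π-α j)))
      ... | eA j _ (inj₂ (refl , refl)) = inj₁ (trans (π-α j) (sym (π-pa j)))
      ... | eB j _ (inj₁ (refl , refl)) = inj₁ (trans (π-pb j) (sym (π-β j)))
      ... | eB j _ (inj₂ (refl , refl)) = inj₁ (trans (π-β j) (sym (π-pb j)))

      embReach : ∀ {a b} → Reach (adjL cG) a b → Reach (adjL cl) (o a) (o b)
      embReach = Reach-map o (λ a b e → inj₂ (emb a b e))
        where
        emb : ∀ a b → adjL cG a b ≡ true → adjL cl (o a) (o b) ≡ true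
        emb a b e with adjL-∈ cG a b e
        ... | (c , d) , cd∈ , inj₁ (refl , refl) = ∈-adjL (subG cd∈)
        ... | (c , d) , cd∈ , inj₂ (refl , refl) = trans (adjL-sym cl (o d) (o c)) (∈-adjL (subG cd∈))

      rb : Bool
      rb = lookup So v

      rootedCase floatingCase splitConn : Bool
      rootedCase   = Φ n₀ So cG ∧ (rooted rb Sa Ea ∧ rooted rb Sb Eb)
      floatingCase = noneChosen EG ∧ ((floating Sa Ea ∧ rooted false Sb Eb) ∨ (rooted false Sa Ea ∧ floating Sb Eb))
      splitConn    = if anyF (lookup So) then rootedCase else floatingCase

      -- So ≠ ∅: project to G, and read off both paths from 'rooted-of-conn'
      conn⇒rootedCase : ConnSub N S cl → anyF (lookup So) ≡ true → rootedCase ≡ true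
      conn⇒rootedCase C So-nonempty = ∧-i ΦG (∧-i rootedA rootedB)
        where
        u : Fin n₀
        u = proj₁ (anyF-∃ (lookup So) So-nonempty)
        su : lookup So u ≡ true
        su = proj₂ (anyF-∃ (lookup So) So-nonempty)
        inG : ∀ {z} → z ∈ cG → lookup So (proj₁ z) ≡ true × lookup So (proj₂ z) ≡ true
        inG {c , d} cd∈ with allIn-∈ {S = S} (proj₁ (proj₂ C)) (subG cd∈)
        ... | x , y = trans (sym (lookS-o c)) x , trans (sym (lookS-o d)) y
        reachG : ∀ a w → lookup So a ≡ true → lookup So w ≡ true → Reach (adjL cG) a w
        reachG a w sa sw = subst₂ (Reach (adjL cG)) (π-o a) (π-o w)
          (Reach-map π π-step (SA.reachC C (trans (lookS-o a) sa) (trans (lookS-o w) sw)))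
        ΦG : Φ n₀ So cG ≡ true
        ΦG = ConnSub→Φ n₀ So cG ((u , su) , ∈-allIn cG So inG , reachG)
        rootedA : rooted rb Sa Ea ≡ true
        rootedA = subst (λ t → rooted t Sa Ea ≡ true) (lookS-o v) (SA.rooted-of-conn C (o u , trans (lookS-o u) su , idxA-o u))
        rootedB : rooted rb Sb Eb ≡ true
        rootedB = subst (λ t → rooted t Sb Eb ≡ true) (lookS-o v) (SB.rooted-of-conn C (o u , trans (lookS-o u) su , idxB-o u))

      -- So = ∅: no edge of G is chosen; a selected vertex lies on one path,
      -- whose part is floating, while the other path is rooted at the
      -- unselected v, hence empty
      conn⇒floatingCase : ConnSub N S cl → anyF (lookup So) ≡ false → floatingCase ≡ true
      conn⇒floatingCase C So-empty = ∧-i EG-empty (byView (view x₀) (proj₂ (proj₁ C)))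
        where
        So-false : ∀ a → lookup So a ≡ false
        So-false = anyF-false (lookup So) So-empty
        v∉S : lookup S (o v) ≡ false
        v∉S = trans (lookS-o v) (So-false v)
        EG-empty : noneChosen EG ≡ true
        EG-empty with noneChosen EG in e
        ... | true = refl
        ... | false with chosen-nonempty (edges G) EG e
        ...   | (c , d) , cd∈ =
                ⊥-elim (true∧false (trans (sym (lookS-o c)) (proj₁ (allIn-∈ {S = S} (proj₁ (proj₂ C)) (subG cd∈)))) (So-false c))
        x₀ : Fin N
        x₀ = proj₁ (proj₁ C)
        byView : ∀ {x} → View x → lookup S x ≡ true →
          ((floating Sa Ea ∧ rooted false Sb Eb) ∨ (rooted false Sa Ea ∧ floating Sb Eb)) ≡ true
        byView (vo a) sx = ⊥-elim (true∧false (trans (sym (lookS-o a)) sx) (So-false a))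
        byView (va i) sx = ∨-l _ (∧-i (SA.floating-of-conn C v∉S (i , trans (sym (lookS-α i)) sx))
          (subst (λ t → rooted t Sb Eb ≡ true) v∉S (SB.rooted-of-conn C (α i , sx , idxB-α i))))
        byView (vb j) sx = ∨-r (floating Sa Ea ∧ rooted false Sb Eb)
          (∧-i (subst (λ t → rooted t Sa Ea ≡ true) v∉S (SA.rooted-of-conn C (β j , sx , idxA-β j)))
               (SB.floating-of-conn C v∉S (j , trans (sym (lookS-β j)) sx)))

      -- (case analysis on So by an explicit equation: abstracting
      -- 'anyF (lookup So)' with 'with' would also rewrite it inside Φ)
      conn⇒split : ConnSub N S cl → splitConn ≡ true
      conn⇒split C = by-So (anyF (lookup So)) refl
        where
        by-So : ∀ c → anyF (lookup So) ≡ c → splitConn ≡ true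
        by-So true  e = trans (if-true e) (conn⇒rootedCase C e)
        by-So false e = trans (if-false e) (conn⇒floatingCase C e)

      -- So ≠ ∅: every selected vertex reaches a fixed selected old vertex u
      rootedCase⇒conn : rootedCase ≡ true → ConnSub N S cl
      rootedCase⇒conn h = (o u , trans (lookS-o u) su) , ∈-allIn cl S inS , reach
        where
        ΦG : Φ n₀ So cG ≡ true
        ΦG = proj₁ (∧-T h)
        rootedA : rooted rb Sa Ea ≡ true
        rootedA = proj₁ (∧-T (proj₂ (∧-T {Φ n₀ So cG} h)))
        rootedB : rooted rb Sb Eb ≡ true
        rootedB = proj₂ (∧-T {rooted rb Sa Ea} (proj₂ (∧-T {Φ n₀ So cG} h)))
        CG : ConnSub n₀ So cG
        CG = Φ→ConnSub n₀ So cG ΦG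
        u : Fin n₀
        u = proj₁ (proj₁ CG)
        su : lookup So u ≡ true
        su = proj₂ (proj₁ CG)
        reachG : ∀ a w → lookup So a ≡ true → lookup So w ≡ true → Reach (adjL cG) a w
        reachG = proj₂ (proj₂ CG)
        pathEdge-in : ∀ {m} (f : Fin m → Fin N) (Sm Em : Vec Bool m) → (∀ i → lookup S (f i) ≡ lookup Sm i) →
          rooted rb Sm Em ≡ true → ∀ j → lookup Em j ≡ true →
          lookup S (pathPrev (o v) f j) ≡ true × lookup S (f j) ≡ true
        pathEdge-in f Sm Em look r j ej with rooted-char⁻ rb Sm Em r
        ... | E≡S , prev∈ =
          trans (prevBit-lookup S _ (o v) f Sm rb (lookS-o v) look j) (prev∈ j (trans (sym (E≡S j)) ej)) ,
          trans (look j) (trans (sym (E≡S j)) ej)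
        inS : ∀ {z} → z ∈ cl → lookup S (proj₁ z) ≡ true × lookup S (proj₂ z) ≡ true
        inS z∈ with ∈-++⁻ (map embG cG) z∈
        ... | inj₁ zG with ∈-map⁻ embG zG
        ...   | (c , d) , cd∈ , refl with allIn-∈ {S = So} (proj₁ (proj₂ CG)) cd∈
        ...     | x , y = trans (lookS-o c) x , trans (lookS-o d) y
        inS z∈ | inj₂ z' with ∈-++⁻ clA z'
        ... | inj₁ zA with ∈chosenPath⁻ p (o v) α Ea zA
        ...   | j , ej , refl = pathEdge-in α Sa Ea lookS-α rootedA j ej
        inS z∈ | inj₂ z' | inj₂ zB with ∈chosenPath⁻ q (o v) β Eb zB
        ...   | j , ej , refl = pathEdge-in β Sb Eb lookS-β rootedB j ej
        toHub : ∀ {x} → View x → lookup S x ≡ true → Reach (adjL cl) x (o u)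
        toHub (vo a) sx = embReach (reachG a u (trans (sym (lookS-o a)) sx) su)
        toHub (va i) sx = Reach-trans (PathReach.rooted-reach cl p (o v) α Sa Ea rb subA rootedA i si)
                                      (embReach (reachG v u (rooted-root rb Sa Ea rootedA i si) su))
          where si = trans (sym (lookS-α i)) sx
        toHub (vb i) sx = Reach-trans (PathReach.rooted-reach cl q (o v) β Sb Eb rb subB rootedB i si)
                                      (embReach (reachG v u (rooted-root rb Sb Eb rootedB i si) su))
          where si = trans (sym (lookS-β i)) sx
        reach : ∀ x y → lookup S x ≡ true → lookup S y ≡ true → Reach (adjL cl) x y
        reach x y sx sy = Reach-trans (toHub (view x) sx) (Reach-sym (adjL-sym cl) (toHub (view y) sy))

      -- So = ∅: a subgraph living on one path only ('this'), the other path
      -- and G contributing nothing; stated once for both paths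
      module OnePathOnly {m m'} (f : Fin m → Fin N) (f' : Fin m' → Fin N)
        (Sm Em : Vec Bool m) (Sm' Em' : Vec Bool m')
        (look : ∀ i → lookup S (f i) ≡ lookup Sm i) (look' : ∀ j → lookup S (f' j) ≡ lookup Sm' j)
        (sub : ∀ {z} → z ∈ chosenPath m (o v) f Em → z ∈ cl)
        (edge-cases : ∀ {z} → z ∈ cl → z ∈ map embG cG ⊎ (z ∈ chosenPath m (o v) f Em ⊎ z ∈ chosenPath m' (o v) f' Em'))
        (vertex-cases : ∀ x → SideView f f' x) where

        connected : anyF (lookup So) ≡ false → noneChosen EG ≡ true →
                    floating Sm Em ≡ true → rooted false Sm' Em' ≡ true → ConnSub N S cl
        connected So-empty EG-empty fl ro = (f hub , trans (look hub) hub∈) , ∈-allIn cl S inS , reach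
          where
          So-false : ∀ a → lookup So a ≡ false
          So-false = anyF-false (lookup So) So-empty
          hub : Fin m
          hub = proj₁ (PathReach.floating-reach cl m (o v) f Sm Em sub fl)
          hub∈ : lookup Sm hub ≡ true
          hub∈ = proj₁ (proj₂ (PathReach.floating-reach cl m (o v) f Sm Em sub fl))
          toHub-this : ∀ t → lookup Sm t ≡ true → Reach (adjL cl) (f t) (f hub)
          toHub-this = proj₂ (proj₂ (PathReach.floating-reach cl m (o v) f Sm Em sub fl))
          inS : ∀ {z} → z ∈ cl → lookup S (proj₁ z) ≡ true × lookup S (proj₂ z) ≡ true
          inS z∈ with edge-cases z∈
          ... | inj₁ zG rewrite chosen-noneChosen (edges G) EG EG-empty with () ← zG
          ... | inj₂ (inj₁ z-this) with ∈chosenPath⁻ m (o v) f Em z-this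
          ...   | j , ej , refl with floating-ends Sm Em fl j ej
          ...     | prev∈ , j∈ = trans (prevBit-lookup S m (o v) f Sm false (trans (lookS-o v) (So-false v)) look j) prev∈ ,
                                 trans (look j) j∈
          inS z∈ | inj₂ (inj₂ z-that) with ∈chosenPath⁻ m' (o v) f' Em' z-that
          ...   | j , ej , refl = ⊥-elim (true∧false ej (rooted-false-E Sm' Em' ro j))
          toHub : ∀ {x} → SideView f f' x → lookup S x ≡ true → Reach (adjL cl) x (f hub)
          toHub (at-old a)  sx = ⊥-elim (true∧false (trans (sym (lookS-o a)) sx) (So-false a))
          toHub (on-this t) sx = toHub-this t (trans (sym (look t)) sx)
          toHub (on-that j) sx = ⊥-elim (true∧false (trans (sym (look' j)) sx) (rooted-false Sm' Em' ro j))
          reach : ∀ x y → lookup S x ≡ true → lookup S y ≡ true → Reach (adjL cl) x y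
          reach x y sx sy = Reach-trans (toHub (vertex-cases x) sx) (Reach-sym (adjL-sym cl) (toHub (vertex-cases y) sy))

      cl-casesA : ∀ {z} → z ∈ cl → z ∈ map embG cG ⊎ (z ∈ clA ⊎ z ∈ clB)
      cl-casesA z∈ with ∈-++⁻ (map embG cG) z∈
      ... | inj₁ zG = inj₁ zG
      ... | inj₂ z' = inj₂ (∈-++⁻ clA z')

      cl-casesB : ∀ {z} → z ∈ cl → z ∈ map embG cG ⊎ (z ∈ clB ⊎ z ∈ clA)
      cl-casesB z∈ with ∈-++⁻ (map embG cG) z∈
      ... | inj₁ zG = inj₁ zG
      ... | inj₂ z' with ∈-++⁻ clA z'
      ...   | inj₁ zA = inj₂ (inj₂ zA)
      ...   | inj₂ zB = inj₂ (inj₁ zB)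

      module OnlyA = OnePathOnly α β Sa Ea Sb Eb lookS-α lookS-β subA cl-casesA viewα
      module OnlyB = OnePathOnly β α Sb Eb Sa Ea lookS-β lookS-α subB cl-casesB viewβ

      floatingCase⇒conn : anyF (lookup So) ≡ false → floatingCase ≡ true → ConnSub N S cl
      floatingCase⇒conn So-empty h with ∧-T {noneChosen EG} h
      ... | EG-empty , paths with ∨-T {floating Sa Ea ∧ rooted false Sb Eb} paths
      ...   | inj₁ A-only = OnlyA.connected So-empty EG-empty (proj₁ (∧-T A-only)) (proj₂ (∧-T {floating Sa Ea} A-only))
      ...   | inj₂ B-only = OnlyB.connected So-empty EG-empty (proj₂ (∧-T {rooted false Sa Ea} B-only)) (proj₁ (∧-T B-only))

      split⇒conn : splitConn ≡ true → ConnSub N S cl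
      split⇒conn h = by-So (anyF (lookup So)) refl
        where
        by-So : ∀ c → anyF (lookup So) ≡ c → ConnSub N S cl
        by-So true  e = rootedCase⇒conn (trans (sym (if-true e)) h)
        by-So false e = floatingCase⇒conn e (trans (sym (if-false e)) h)

      conn≡split : Φ N S cl ≡ splitConn
      conn≡split = bool-ext (λ e → conn⇒split (Φ→ConnSub N S cl e)) (λ e → ConnSub→Φ N S cl (split⇒conn e))

module PathCounts where

  open import Defs using (anyF)
  open Basics
  open VectorSums
  open EdgeSelections using (noneChosen)
  open PendantPaths using (rooted; floating)
  open import Data.Bool using (Bool; true; false; _∧_; _∨_; if_then_else_)
  open import Data.Nat using (ℕ; zero; suc; _+_; _*_)
  open import Data.Nat.Properties
  open import Data.Vec using (Vec; _∷_; lookup)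
  open import Data.Empty using (⊥; ⊥-elim)
  open import Relation.Binary.PropositionalEquality

  𝟙-∧ : ∀ a b → 𝟙 (a ∧ b) ≡ 𝟙 a * 𝟙 b
  𝟙-∧ true  b = sym (+-identityʳ (𝟙 b))
  𝟙-∧ false b = refl

  𝟙-∨ : ∀ a b → (a ≡ true → b ≡ true → ⊥) → 𝟙 (a ∨ b) ≡ 𝟙 a + 𝟙 b
  𝟙-∨ true  true  h = ⊥-elim (h refl refl)
  𝟙-∨ true  false h = refl
  𝟙-∨ false b     h = refl

  pairSum : (m : ℕ) → (Vec Bool m → Vec Bool m → ℕ) → ℕ
  pairSum m g = sumAll m (λ S → sumAll m (λ E → g S E))

  pairSum-suc : ∀ m (g : Vec Bool (suc m) → Vec Bool (suc m) → ℕ) →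
    pairSum (suc m) g ≡
    pairSum m (λ S E → (g (true ∷ S) (true ∷ E) + g (true ∷ S) (false ∷ E)) + (g (false ∷ S) (true ∷ E) + g (false ∷ S) (false ∷ E)))
  pairSum-suc m g = sumAll-ext m _ _ (λ S → sym (sumAll-+ m _ _))

  pairSum-ext : ∀ m (f g : Vec Bool m → Vec Bool m → ℕ) → (∀ S E → f S E ≡ g S E) → pairSum m f ≡ pairSum m g
  pairSum-ext m f g h = sumAll-ext m _ _ (λ S → sumAll-ext m _ _ (λ E → h S E))

  pairSum-+ : ∀ m (f g : Vec Bool m → Vec Bool m → ℕ) → pairSum m (λ S E → f S E + g S E) ≡ pairSum m f + pairSum m g
  pairSum-+ m f g = trans (sumAll-ext m _ _ (λ S → sumAll-+ m _ _)) (sumAll-+ m _ _)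

  rootedCount : Bool → ℕ → ℕ
  rootedCount r m = pairSum m (λ S E → 𝟙 (rooted r S E))

  rootedCount-false : ∀ m → rootedCount false m ≡ 1
  rootedCount-false zero    = refl
  rootedCount-false (suc m) = trans (pairSum-suc m (λ S E → 𝟙 (rooted false S E))) (rootedCount-false m)

  -- either f₀ is unselected (then so is everything: 1 way) or it is
  -- selected with its edge, and the rest is rooted at f₀ (m + 1 ways)
  rootedCount-true : ∀ m → rootedCount true m ≡ suc m
  rootedCount-true zero    = refl
  rootedCount-true (suc m) = begin
    rootedCount true (suc m)
      ≡⟨ pairSum-suc m (λ S E → 𝟙 (rooted true S E)) ⟩
    pairSum m (λ S E → (𝟙 (rooted true S E) + 0) + 𝟙 (rooted false S E))
      ≡⟨ pairSum-ext m _ _ (λ S E → cong (_+ 𝟙 (rooted false S E)) (+-identityʳ (𝟙 (rooted true S E)))) ⟩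
    pairSum m (λ S E → 𝟙 (rooted true S E) + 𝟙 (rooted false S E))
      ≡⟨ pairSum-+ m (λ S E → 𝟙 (rooted true S E)) (λ S E → 𝟙 (rooted false S E)) ⟩
    rootedCount true m + rootedCount false m
      ≡⟨ cong₂ _+_ (rootedCount-true m) (rootedCount-false m) ⟩
    suc m + 1
      ≡⟨ +-comm (suc m) 1 ⟩
    suc (suc m) ∎
    where open ≡-Reasoning

  triangle : ℕ → ℕ
  triangle zero    = 0
  triangle (suc m) = suc m + triangle m

  -- either the floating segment starts at f₀ (m + 1 ways) or it lies in the
  -- tail (triangle m ways)
  floating-count : ∀ m → pairSum m (λ S E → 𝟙 (floating S E)) ≡ triangle m
  floating-count zero    = refl
  floating-count (suc m) =
    trans (pairSum-suc m (λ S E → 𝟙 (floating S E)))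
      (trans (pairSum-+ m (λ S E → 𝟙 (rooted true S E)) (λ S E → 𝟙 (floating S E)))
             (cong₂ _+_ (rootedCount-true m) (floating-count m)))

  noneChosen-count : ∀ m → sumAll m (λ E → 𝟙 (noneChosen E)) ≡ 1
  noneChosen-count zero    = refl
  noneChosen-count (suc m) = noneChosen-count m

  sumAll-onlyEmpty : ∀ m c → sumAll m (λ S → if anyF (lookup S) then 0 else c) ≡ c
  sumAll-onlyEmpty zero    c = refl
  sumAll-onlyEmpty (suc m) c = sumAll-onlyEmpty m c

  sumAll-factor : ∀ p q e (φ : Vec Bool e → ℕ) (a : Vec Bool p → Vec Bool p → ℕ) (b : Vec Bool q → Vec Bool q → ℕ) →
    sumAll p (λ Sa → sumAll q (λ Sb → sumAll e (λ EG → sumAll p (λ Ea → sumAll q (λ Eb → φ EG * (a Sa Ea * b Sb Eb)))))) ≡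
    sumAll e φ * (pairSum p a * pairSum q b)
  sumAll-factor p q e φ a b = begin
    sumAll p (λ Sa → sumAll q (λ Sb → sumAll e (λ EG → sumAll p (λ Ea → sumAll q (λ Eb → φ EG * (a Sa Ea * b Sb Eb))))))
      ≡⟨ sumAll-ext p _ _ (λ Sa → sumAll-ext q _ _ (λ Sb → sumAll-ext e _ _ (λ EG → edge-sums Sa Sb EG))) ⟩
    sumAll p (λ Sa → sumAll q (λ Sb → sumAll e (λ EG → φ EG * (A Sa * B Sb))))
      ≡⟨ sumAll-ext p _ _ (λ Sa → sumAll-ext q _ _ (λ Sb → sumAll-*ʳ e φ (A Sa * B Sb))) ⟩
    sumAll p (λ Sa → sumAll q (λ Sb → Φs * (A Sa * B Sb)))
      ≡⟨ sumAll-ext p _ _ (λ Sa → sumAll-* q Φs (λ Sb → A Sa * B Sb)) ⟩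
    sumAll p (λ Sa → Φs * sumAll q (λ Sb → A Sa * B Sb))
      ≡⟨ sumAll-* p Φs _ ⟩
    Φs * sumAll p (λ Sa → sumAll q (λ Sb → A Sa * B Sb))
      ≡⟨ cong (Φs *_) (sumAll-product p q A B) ⟩
    Φs * (pairSum p a * pairSum q b) ∎
    where
    open ≡-Reasoning
    Φs : ℕ
    Φs = sumAll e φ
    A : Vec Bool p → ℕ
    A Sa = sumAll p (a Sa)
    B : Vec Bool q → ℕ
    B Sb = sumAll q (b Sb)
    edge-sums : ∀ Sa Sb EG → sumAll p (λ Ea → sumAll q (λ Eb → φ EG * (a Sa Ea * b Sb Eb))) ≡ φ EG * (A Sa * B Sb)
    edge-sums Sa Sb EG =
      trans (sumAll-ext p _ _ (λ Ea → sumAll-* q (φ EG) (λ Eb → a Sa Ea * b Sb Eb)))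
        (trans (sumAll-* p (φ EG) _) (cong (φ EG *_) (sumAll-product p q (a Sa) (b Sb))))

module CountingFormula where

  open import Defs using (Graph; n; edges; isConnSub; F; anyF)
  open Basics
  open VectorSums
  open EdgeSelections
  open AttachedEdges
  open PendantPaths
  open Decomposition
  open PathCounts
  open import Data.Bool using (Bool; true; false; _∧_; _∨_; not; if_then_else_)
  open import Data.Nat using (ℕ; suc; _+_; _*_)
  open import Data.Nat.Properties
  open import Data.Nat.Tactic.RingSolver using (solve-∀)
  open import Data.Fin using (Fin)
  open import Data.Vec using (Vec; lookup)
  open import Data.List using (length; map)
  import Data.List as L
  open import Data.Product using (_,_; proj₁)
  open import Data.Empty using (⊥)
  open import Relation.Binary.PropositionalEquality

  -- Summing the indicator of 'splitConn' from the
  -- decomposition: for So ≠ ∅ the paths contribute a factor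
  -- rootedCount p · rootedCount q, which is (p+1)(q+1) if v ∈ So and 1
  -- otherwise; So = ∅ contributes the floating subgraphs inside either path.

  connCount : (G : Graph) → Vec Bool (n G) → ℕ
  connCount G So = sumAll (length (edges G)) (λ EG → 𝟙 (Φ (n G) So (chosen (edges G) EG)))

  withV withoutV : (G : Graph) → Fin (n G) → ℕ
  withV    G v = sumAll (n G) (λ So → 𝟙 (lookup So v) * connCount G So)
  withoutV G v = sumAll (n G) (λ So → 𝟙 (not (lookup So v)) * connCount G So)

  module Formula (G : Graph) (v : Fin (n G)) (p q : ℕ) where
    open Attached G v p q
    open Projections G v p q

    e : ℕ
    e = length (edges G)

    -- summing over edge subsets of H is summing over (EG, Ea, Eb): rewrite
    -- isConnSub as Φ, permute 'edges H' into 'listedEdges', split the sum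
    -- along the three blocks, and move the renaming embG out of 'chosen'
    edge-sum : ∀ S → sumAll (length (edges H)) (λ E → 𝟙 (isConnSub H S E)) ≡
      sumAll e (λ EG → sumAll p (λ Ea → sumAll q (λ Eb →
        𝟙 (Φ N S (map embG (chosen (edges G) EG) L.++ (chosenPath p (o v) α Ea L.++ chosenPath q (o v) β Eb))))))
    edge-sum S =
      trans (sumAll-ext (length (edges H)) _ _ (λ E → cong 𝟙 (isConnSub-Φ H S E)))
     (trans (sumChosen-↭ edges-attach↭listed (λ c → 𝟙 (Φ N S c)) (λ pr → cong 𝟙 (Φ-↭ S pr)))
     (trans (sumChosen-++ (map embG (edges G)) (pathEdges p (o v) α L.++ pathEdges q (o v) β) (λ c → 𝟙 (Φ N S c)))
     (trans (sumAll-ext (length (map embG (edges G))) _ _ (λ E₁ → path-sums (chosen (map embG (edges G)) E₁)))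
     (sumChosen-map embG (edges G) (λ c → sumAll p (λ Ea → sumAll q (λ Eb →
         𝟙 (Φ N S (c L.++ (chosenPath p (o v) α Ea L.++ chosenPath q (o v) β Eb))))))))))
      where
      path-sums : ∀ c₁ → sumAll (length (pathEdges p (o v) α L.++ pathEdges q (o v) β))
                           (λ E₂ → 𝟙 (Φ N S (c₁ L.++ chosen (pathEdges p (o v) α L.++ pathEdges q (o v) β) E₂))) ≡
                         sumAll p (λ Ea → sumAll q (λ Eb → 𝟙 (Φ N S (c₁ L.++ (chosenPath p (o v) α Ea L.++ chosenPath q (o v) β Eb)))))
      path-sums c₁ = trans (sumChosen-++ (pathEdges p (o v) α) (pathEdges q (o v) β) (λ c → 𝟙 (Φ N S (c₁ L.++ c))))
        (trans (sumChosen-path p (o v) α (λ c → sumAll (length (pathEdges q (o v) β))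
                                                  (λ Eb → 𝟙 (Φ N S (c₁ L.++ (c L.++ chosen (pathEdges q (o v) β) Eb))))))
               (sumAll-ext p _ _ (λ Ea → sumChosen-path q (o v) β (λ c → 𝟙 (Φ N S (c₁ L.++ (chosenPath p (o v) α Ea L.++ c)))))))

    sumSplit : (Vec Bool p → Vec Bool q → Vec Bool e → Vec Bool p → Vec Bool q → ℕ) → ℕ
    sumSplit g = sumAll p (λ Sa → sumAll q (λ Sb → sumAll e (λ EG → sumAll p (λ Ea → sumAll q (λ Eb → g Sa Sb EG Ea Eb)))))

    sumSplit-ext : ∀ f g → (∀ Sa Sb EG Ea Eb → f Sa Sb EG Ea Eb ≡ g Sa Sb EG Ea Eb) → sumSplit f ≡ sumSplit g
    sumSplit-ext f g h = sumAll-ext p _ _ (λ Sa → sumAll-ext q _ _ (λ Sb → sumAll-ext e _ _ (λ EG → sumAll-ext p _ _ (λ Ea →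
                           sumAll-ext q _ _ (λ Eb → h Sa Sb EG Ea Eb)))))

    sumSplit-+ : ∀ f g → sumSplit (λ Sa Sb EG Ea Eb → f Sa Sb EG Ea Eb + g Sa Sb EG Ea Eb) ≡ sumSplit f + sumSplit g
    sumSplit-+ f g =
      trans (sumAll-ext p _ _ (λ Sa → trans (sumAll-ext q _ _ (λ Sb → trans (sumAll-ext e _ _ (λ EG →
        trans (sumAll-ext p _ _ (λ Ea → sumAll-+ q _ _)) (sumAll-+ p _ _))) (sumAll-+ e _ _))) (sumAll-+ q _ _)))
        (sumAll-+ p _ _)

    fiber : Vec Bool n₀ → ℕ
    fiber So = sumSplit (λ Sa Sb EG Ea Eb → 𝟙 (Selection.splitConn So Sa Sb EG Ea Eb))

    F-as-fibers : F H ≡ sumAll n₀ fiber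
    F-as-fibers = trans (F-as-sum H)
      (trans (sumAll-ext N _ _ edge-sum)
      (trans (sumAll-split n₀ (p + q) _)
      (sumAll-ext n₀ _ _ (λ So → trans (sumAll-split p q _)
        (sumSplit-ext _ _ (λ Sa Sb EG Ea Eb → cong 𝟙 (Selection.conn≡split So Sa Sb EG Ea Eb)))))))

    pathWeight : Bool → ℕ
    pathWeight true  = suc p * suc q
    pathWeight false = 1

    rootedCount-weight : ∀ r → rootedCount r p * rootedCount r q ≡ pathWeight r
    rootedCount-weight true  = cong₂ _*_ (rootedCount-true p) (rootedCount-true q)
    rootedCount-weight false = cong₂ _*_ (rootedCount-false p) (rootedCount-false q)

    fiber-nonempty : ∀ So → anyF (lookup So) ≡ true → fiber So ≡ connCount G So * pathWeight (lookup So v)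
    fiber-nonempty So So≠∅ = trans (sumSplit-ext _ _ product)
      (trans (sumAll-factor p q e (λ EG → 𝟙 (Φ n₀ So (chosen (edges G) EG))) (λ Sa Ea → 𝟙 (rooted r Sa Ea)) (λ Sb Eb → 𝟙 (rooted r Sb Eb)))
             (cong (connCount G So *_) (rootedCount-weight r)))
      where
      r : Bool
      r = lookup So v
      product : ∀ Sa Sb EG Ea Eb → 𝟙 (Selection.splitConn So Sa Sb EG Ea Eb) ≡
                𝟙 (Φ n₀ So (chosen (edges G) EG)) * (𝟙 (rooted r Sa Ea) * 𝟙 (rooted r Sb Eb))
      product Sa Sb EG Ea Eb = trans (cong 𝟙 (if-true So≠∅))
        (trans (𝟙-∧ (Φ n₀ So (chosen (edges G) EG)) _) (cong (𝟙 (Φ n₀ So (chosen (edges G) EG)) *_) (𝟙-∧ (rooted r Sa Ea) _)))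

    fiber-empty : ∀ So → anyF (lookup So) ≡ false → fiber So ≡ triangle p + triangle q
    fiber-empty So So≡∅ = trans (sumSplit-ext _ _ two-products)
      (trans (sumSplit-+ _ _)
      (trans (cong₂ _+_ (sumAll-factor p q e (λ EG → 𝟙 (noneChosen EG)) (λ Sa Ea → 𝟙 (floating Sa Ea)) (λ Sb Eb → 𝟙 (rooted false Sb Eb)))
                        (sumAll-factor p q e (λ EG → 𝟙 (noneChosen EG)) (λ Sa Ea → 𝟙 (rooted false Sa Ea)) (λ Sb Eb → 𝟙 (floating Sb Eb))))
      (trans (cong₂ _+_ (cong₂ _*_ (noneChosen-count e) (cong₂ _*_ (floating-count p) (rootedCount-false q)))
                        (cong₂ _*_ (noneChosen-count e) (cong₂ _*_ (rootedCount-false p) (floating-count q))))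
             (units (triangle p) (triangle q)))))
      where
      units : ∀ a b → 1 * (a * 1) + 1 * (1 * b) ≡ a + b
      units = solve-∀
      -- the two cases are exclusive: a floating first path is nonempty
      exclusive : ∀ Sa Sb Ea Eb → (floating Sa Ea ∧ rooted false Sb Eb) ≡ true → (rooted false Sa Ea ∧ floating Sb Eb) ≡ true → ⊥
      exclusive Sa Sb Ea Eb x y with floating-nonempty Sa Ea (proj₁ (∧-T x))
      ... | h , sh = true∧false sh (rooted-false Sa Ea (proj₁ (∧-T y)) h)
      two-products : ∀ Sa Sb EG Ea Eb → 𝟙 (Selection.splitConn So Sa Sb EG Ea Eb) ≡
           𝟙 (noneChosen EG) * (𝟙 (floating Sa Ea) * 𝟙 (rooted false Sb Eb)) +
           𝟙 (noneChosen EG) * (𝟙 (rooted false Sa Ea) * 𝟙 (floating Sb Eb))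
      two-products Sa Sb EG Ea Eb = trans (cong 𝟙 (if-false So≡∅))
        (trans (𝟙-∧ (noneChosen EG) _)
        (trans (cong (𝟙 (noneChosen EG) *_) (𝟙-∨ (floating Sa Ea ∧ rooted false Sb Eb) _ (exclusive Sa Sb Ea Eb)))
        (trans (*-distribˡ-+ (𝟙 (noneChosen EG)) _ _)
               (cong₂ _+_ (cong (𝟙 (noneChosen EG) *_) (𝟙-∧ (floating Sa Ea) _))
                          (cong (𝟙 (noneChosen EG) *_) (𝟙-∧ (rooted false Sa Ea) _))))))

    connCount-empty : ∀ So → anyF (lookup So) ≡ false → connCount G So ≡ 0
    connCount-empty So So≡∅ = trans (sumAll-ext e _ _ (λ EG → cong (λ t → 𝟙 (t ∧ spans n₀ So (chosen (edges G) EG))) So≡∅)) (sumAll-0 e)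

    fiber-sum : ∀ So → fiber So ≡ connCount G So * pathWeight (lookup So v) + (if anyF (lookup So) then 0 else (triangle p + triangle q))
    fiber-sum So = by-So (anyF (lookup So)) refl
      where
      by-So : ∀ c → anyF (lookup So) ≡ c →
              fiber So ≡ connCount G So * pathWeight (lookup So v) + (if anyF (lookup So) then 0 else (triangle p + triangle q))
      by-So true  e = trans (fiber-nonempty So e) (sym (trans (cong (connCount G So * pathWeight (lookup So v) +_) (if-true e)) (+-identityʳ _)))
      by-So false e = trans (fiber-empty So e) (sym (cong₂ _+_ (cong (_* pathWeight (lookup So v)) (connCount-empty So e)) (if-false e)))

    weight-split : ∀ So → connCount G So * pathWeight (lookup So v) ≡
                   (suc p * suc q) * (𝟙 (lookup So v) * connCount G So) + 𝟙 (not (lookup So v)) * connCount G So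
    weight-split So with lookup So v
    ... | true  = with-v (connCount G So) (suc p * suc q)
      where
      with-v : ∀ x K → x * K ≡ K * (x + 0) + 0
      with-v = solve-∀
    ... | false = without-v (connCount G So) (suc p * suc q)
      where
      without-v : ∀ x K → x * 1 ≡ K * 0 + (x + 0)
      without-v = solve-∀

    F-attach : F H ≡ ((suc p * suc q) * withV G v + withoutV G v) + (triangle p + triangle q)
    F-attach = trans F-as-fibers
      (trans (sumAll-ext n₀ _ _ fiber-sum)
      (trans (sumAll-+ n₀ _ _)
      (cong₂ _+_ (trans (sumAll-ext n₀ _ _ weight-split) (trans (sumAll-+ n₀ _ _) (cong (_+ withoutV G v) (sumAll-* n₀ (suc p * suc q) _))))
                 (sumAll-onlyEmpty n₀ (triangle p + triangle q)))))

module Comparison where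

  open import Defs using (Graph; n; adj; irrefl; edges; Connected; _==_)
  import Defs
  open Basics
  open Walks
  open VectorSums
  open EdgeSelections
  open AttachedEdges using (∈edges⁺)
  open PathCounts using (triangle)
  open CountingFormula
  open import Data.Bool using (Bool; true; false; _∨_)
  open import Data.Nat using (ℕ; zero; suc; _+_; _*_; _≤_; _<_; z≤n; s≤s; _≟_)
  open import Data.Nat.Properties
  open import Data.Nat.Tactic.RingSolver using (solve-∀)
  open import Data.Fin using (Fin; toℕ; fromℕ<)
  open import Data.Fin.Properties using (toℕ-fromℕ<; toℕ-injective)
  open import Data.Vec using (Vec; []; _∷_; lookup; tabulate; replicate)
  open import Data.Vec.Properties using (lookup∘tabulate)
  open import Data.List using (List; []; _∷_; length)
  open import Data.List.Membership.Propositional using (_∈_)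
  open import Data.List.Relation.Unary.Any using (here; there)
  open import Data.Product using (Σ; _×_; _,_; proj₁; proj₂)
  open import Data.Sum using (_⊎_; inj₁; inj₂)
  open import Data.Empty using (⊥-elim)
  open import Relation.Nullary using (¬_; yes; no)
  open import Relation.Binary.Definitions using (tri<; tri≈; tri>)
  open import Relation.Binary.PropositionalEquality

  -- Y = withV G v ≥ 2 when G is connected with at least two vertices:
  -- ({v}, ∅) and ({v, w}, {vw}) for a neighbour w of v are two connected
  -- subgraphs containing v.

  other-vertex : ∀ G → 2 ≤ n G → (v : Fin (n G)) → Σ (Fin (n G)) λ w → ¬ (w ≡ v)
  other-vertex G n≥2 v with toℕ v ≟ 0
  ... | yes v≡0 = fromℕ< n≥2 , λ eq → 1+n≢0 (trans (sym (toℕ-fromℕ< n≥2)) (trans (cong toℕ eq) v≡0))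
  ... | no  v≢0 = fromℕ< (≤-trans (s≤s z≤n) n≥2) ,
                  λ eq → v≢0 (trans (sym (cong toℕ eq)) (toℕ-fromℕ< (≤-trans (s≤s z≤n) n≥2)))

  -- so, in a connected graph, v has a neighbour: the first step of a walk
  -- from v to that vertex
  neighbour : ∀ G → 2 ≤ n G → Connected G → (v : Fin (n G)) → Σ (Fin (n G)) λ w → adj G v w ≡ true × ¬ (w ≡ v)
  neighbour G n≥2 conn v with other-vertex G n≥2 v
  ... | u , u≢v = first-step (walk→Reach (adj G) (n G) v u (T→≡ (conn v u))) (λ v≡u → u≢v (sym v≡u))
    where
    first-step : ∀ {a b} → Reach (adj G) a b → ¬ (a ≡ b) → Σ (Fin (n G)) λ w → adj G a w ≡ true × ¬ (w ≡ a)
    first-step stay a≢a = ⊥-elim (a≢a refl)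
    first-step {a} (step {x = x} r _) _ = x , r , λ { refl → true∧false r (irrefl G a) }

  edge-in : ∀ G a b → adj G a b ≡ true → ¬ (a ≡ b) → Σ (Pair (n G)) λ z → z ∈ edges G × Joins z a b
  edge-in G a b ab a≢b with <-cmp (toℕ a) (toℕ b)
  ... | tri< lt _ _ = (a , b) , ∈edges⁺ G {a , b} (∧-i (T→≡ (<⇒<ᵇ lt)) ab) , inj₁ (refl , refl)
  ... | tri≈ _ eq _ = ⊥-elim (a≢b (toℕ-injective eq))
  ... | tri> _ _ gt = (b , a) , ∈edges⁺ G {b , a} (∧-i (T→≡ (<⇒<ᵇ gt)) (trans (Defs.sym G b a) ab)) , inj₂ (refl , refl)

  noneChosen-replicate : ∀ m → noneChosen (replicate m false) ≡ true
  noneChosen-replicate zero    = refl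
  noneChosen-replicate (suc m) = noneChosen-replicate m

  singleEdge : ∀ {N} {es : List (Pair N)} {z} → z ∈ es → Vec Bool (length es)
  singleEdge {es = x ∷ es} (here _) = true ∷ replicate (length es) false
  singleEdge (there z∈) = false ∷ singleEdge z∈

  chosen-singleEdge : ∀ {N} {es : List (Pair N)} {z} (z∈ : z ∈ es) → chosen es (singleEdge z∈) ≡ z ∷ []
  chosen-singleEdge {es = x ∷ es} (here refl) =
    cong (x ∷_) (chosen-noneChosen es (replicate (length es) false) (noneChosen-replicate (length es)))
  chosen-singleEdge (there z∈) = chosen-singleEdge z∈

  ==-false : ∀ {N} {a b : Fin N} → ¬ (a ≡ b) → (a == b) ≡ false
  ==-false {a = a} {b} a≢b with a == b in eq
  ... | false = refl
  ... | true  = ⊥-elim (a≢b (==-true eq))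

  module TwoSubgraphs (G : Graph) (v w : Fin (n G)) (vw : adj G v w ≡ true) (w≢v : ¬ (w ≡ v)) where

    Sv Svw : Vec Bool (n G)
    Sv  = tabulate (_== v)
    Svw = tabulate (λ x → (x == v) ∨ (x == w))

    look-v : ∀ x → lookup Sv x ≡ (x == v)
    look-v = lookup∘tabulate (_== v)
    look-vw : ∀ x → lookup Svw x ≡ ((x == v) ∨ (x == w))
    look-vw = lookup∘tabulate (λ x → (x == v) ∨ (x == w))

    v∈Svw : lookup Svw v ≡ true
    v∈Svw = trans (look-vw v) (∨-l _ (==-refl v))
    w∈Svw : lookup Svw w ≡ true
    w∈Svw = trans (look-vw w) (∨-r (w == v) (==-refl w))

    Sv≢Svw : ¬ (Sv ≡ Svw)
    Sv≢Svw eq = true∧false w∈Svw (trans (cong (λ S → lookup S w) (sym eq)) (trans (look-v w) (==-false w≢v)))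

    singleton : ConnSub (n G) Sv []
    singleton = (v , trans (look-v v) (==-refl v)) , refl , λ a b a∈ b∈ →
      subst₂ (Reach (adjL [])) (sym (==-true (trans (sym (look-v a)) a∈))) (sym (==-true (trans (sym (look-v b)) b∈))) stay

    vw-listed : Σ (Pair (n G)) λ z → z ∈ edges G × Joins z v w
    vw-listed = edge-in G v w vw (λ v≡w → w≢v (sym v≡w))
    zvw : Pair (n G)
    zvw = proj₁ vw-listed

    single-edge : ConnSub (n G) Svw (zvw ∷ [])
    single-edge = (v , v∈Svw) , ∈-allIn (zvw ∷ []) Svw (λ { (here refl) → ends (proj₂ (proj₂ vw-listed)) }) , reach
      where
      ends : ∀ {z} → Joins z v w → lookup Svw (proj₁ z) ≡ true × lookup Svw (proj₂ z) ≡ true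
      ends (inj₁ (refl , refl)) = v∈Svw , w∈Svw
      ends (inj₂ (refl , refl)) = w∈Svw , v∈Svw
      v~w : adjL (zvw ∷ []) v w ≡ true
      v~w = adjL-intro {cl = zvw ∷ []} v w (here refl) (proj₂ (proj₂ vw-listed))
      v-or-w : ∀ x → lookup Svw x ≡ true → x ≡ v ⊎ x ≡ w
      v-or-w x x∈ with ∨-T {x == v} (trans (sym (look-vw x)) x∈)
      ... | inj₁ h = inj₁ (==-true h)
      ... | inj₂ h = inj₂ (==-true h)
      reach : ∀ x y → lookup Svw x ≡ true → lookup Svw y ≡ true → Reach (adjL (zvw ∷ [])) x y
      reach x y x∈ y∈ with v-or-w x x∈ | v-or-w y y∈
      ... | inj₁ refl | inj₁ refl = stay
      ... | inj₁ refl | inj₂ refl = step v~w stay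
      ... | inj₂ refl | inj₁ refl = step (trans (adjL-sym (zvw ∷ []) w v) v~w) stay
      ... | inj₂ refl | inj₂ refl = stay

    term-pos : ∀ So E → lookup So v ≡ true → Φ (n G) So (chosen (edges G) E) ≡ true → 1 ≤ 𝟙 (lookup So v) * connCount G So
    term-pos So E v∈ h rewrite v∈ = subst (1 ≤_) (sym (+-identityʳ _))
      (subst (λ t → 𝟙 t ≤ connCount G So) h (sumAll-point (length (edges G)) (λ EG → 𝟙 (Φ (n G) So (chosen (edges G) EG))) E))

    withV≥2 : 2 ≤ withV G v
    withV≥2 = ≤-trans (+-mono-≤ one two) (sumAll-two (n G) (λ So → 𝟙 (lookup So v) * connCount G So) Sv Svw Sv≢Svw)
      where
      e : ℕ
      e = length (edges G)
      one : 1 ≤ 𝟙 (lookup Sv v) * connCount G Sv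
      one = term-pos Sv (replicate e false) (trans (look-v v) (==-refl v))
        (subst (λ c → Φ (n G) Sv c ≡ true) (sym (chosen-noneChosen (edges G) (replicate e false) (noneChosen-replicate e)))
               (ConnSub→Φ (n G) Sv [] singleton))
      two : 1 ≤ 𝟙 (lookup Svw v) * connCount G Svw
      two = term-pos Svw (singleEdge (proj₁ (proj₂ vw-listed))) v∈Svw
        (subst (λ c → Φ (n G) Svw c ≡ true) (sym (chosen-singleEdge (proj₁ (proj₂ vw-listed))))
               (ConnSub→Φ (n G) Svw (zvw ∷ []) single-edge))

  withV≥2 : ∀ G → 2 ≤ n G → Connected G → (v : Fin (n G)) → 2 ≤ withV G v
  withV≥2 G n≥2 conn v with neighbour G n≥2 conn v
  ... | w , vw , w≢v = TwoSubgraphs.withV≥2 G v w vw w≢v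

  -- The right-hand side of the counting formula, and the comparison: moving
  -- one vertex from the path of length k+1 to the path of length l ≥ k+1
  -- changes it by -(l-k)·Y + (l-k) = -(l-k)(Y-1) < 0.
  formula : ℕ → ℕ → ℕ → ℕ → ℕ
  formula p q Y X = ((suc p * suc q) * Y + X) + (triangle p + triangle q)

  formula-gap : ∀ k l Y X → 2 ≤ Y → suc k ≤ l → formula k (suc l) Y X < formula (suc k) l Y X
  formula-gap k l Y X Y≥2 k<l with m≤n⇒∃[o]m+o≡n k<l | m≤n⇒∃[o]m+o≡n Y≥2
  ... | d , refl | y , refl =
    subst (formula k (suc l′) Y′ X <_) (sym (gap y X (triangle k) (triangle l′) k d)) (m<m+n _ (s≤s z≤n))
    where
    l′ Y′ : ℕ
    l′ = suc k + d
    Y′ = 2 + y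
    gap : ∀ y X tk tl k d →
      (suc (suc k) * suc (suc k + d)) * (2 + y) + X + ((suc k + tk) + tl) ≡
      ((suc k * suc (suc (suc k + d))) * (2 + y) + X + (tk + (suc (suc k + d) + tl))) + suc y * suc d
    gap = solve-∀

open import Defs using (Graph; n; Connected; F; attach)
open import Data.Nat using (ℕ; _≤_; _<_; pred)
open import Data.Fin using (Fin)
open import Relation.Binary.PropositionalEquality using (sym; subst₂)
open CountingFormula using (module Formula; withV; withoutV)
open Comparison using (withV≥2; formula-gap)

lemma3p4 : (G : Graph) → 2 ≤ n G → Connected G → (v : Fin (n G)) →
    (k l : ℕ) → 1 ≤ k → k ≤ l →
    F (attach G v (pred k) (ℕ.suc l)) < F (attach G v k l)
lemma3p4 G n≥2 conn v (ℕ.suc k) l _ k<l =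
  subst₂ _<_ (sym (Formula.F-attach G v k (ℕ.suc l))) (sym (Formula.F-attach G v (ℕ.suc k) l))
    (formula-gap k l (withV G v) (withoutV G v) (withV≥2 G n≥2 conn v) k<l)
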